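{- Let $p$ be an odd prime and $\gamma\vdash n-2p$ a self-conjugate $p$-core; let $\mathfrak{B}_\gamma$ be the set of partitions of $n$ with $p$-core $\gamma$. The self-conjugate partitions in $\mathfrak{B}_\gamma$ are exactly \[\nu_k=\left\langle\frac{p-1}{2}-k,\ \frac{p-1}{2}+k\right\rangle,\qquad 1\le k\le\frac{p-1}{2}.\]
   Context: Abacus: for a partition $\lambda$, place beads at positions $\lambda_i-i$ ($i\ge1$) on the $p$-abacus (runners indexed by residues mod $p$; moving a bead down one position means $x\mapsto x+p$). For the $p$-core $\gamma$, let $\rho_0<\rho_1<\dots<\rho_{p-1}$ be the positions of the lowest bead on each of the $p$ runners; the runner containing $\rho_r$ is called runner $r$. For $0\le i<j\le p-1$, $\langle i,j\rangle$ denotes the partition (in $\mathfrak{B}_\gamma$) whose abacus is obtained from that of $\gamma$ by moving the beads at positions $\rho_i$ and $\rho_j$ each down one position. -}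

module Defs where

open import Data.Bool using (Bool; true; false; if_then_else_; _∨_)
open import Data.Nat as ℕ using (ℕ; zero; suc; _≤_; _<_; _≥_)
open import Data.Integer as ℤ using (ℤ; +_; -_)
open import Data.List using (List; []; _∷_; length; map; filter; upTo)
open import Data.Nat.ListAction using (sum)
open import Data.Bool.ListAction using (any)
open import Data.List.Relation.Unary.All using (All)
open import Data.List.Relation.Unary.Linked using (Linked)
open import Data.Product using (_×_; ∃-syntax)
open import Relation.Binary.PropositionalEquality using (_≡_)
open import Relation.Binary.Construct.Closure.ReflexiveTransitive using (Star)
open import Relation.Nullary.Decidable using (⌊_⌋)

IsPartition : List ℕ → Set
IsPartition λs = All (0 <_) λs × Linked _≥_ λs

size : List ℕ → ℕ
size = sum

firstPart : List ℕ → ℕ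
firstPart []      = 0
firstPart (a ∷ _) = a

conj : List ℕ → List ℕ
conj λs = map (λ j → length (filter (j ℕ.≤?_) λs)) (map suc (upTo (firstPart λs)))

positionsFrom : ℕ → List ℕ → List ℤ
positionsFrom i []       = []
positionsFrom i (a ∷ as) = (+ a ℤ.- + i) ∷ positionsFrom (suc i) as

-- Abacus (beta set) of λ: x carries a bead iff x = λ_i - i for some i ≥ 1
-- (λ_i = 0 for i > length λ, giving beads at all x < - length λ).
bead : List ℕ → ℤ → Bool
bead λs x = ⌊ x ℤ.<? - (+ length λs) ⌋ ∨ any (λ y → ⌊ x ℤ.≟ y ⌋) (positionsFrom 1 λs)

-- Removal of a rim p-hook = moving a bead from x up to the empty position x - p.
PHookRemoval : ℕ → List ℕ → List ℕ → Set
PHookRemoval p λs μs =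
  ∃[ x ] (bead λs x ≡ true × bead λs (x ℤ.- + p) ≡ false ×
          (∀ y → bead μs y ≡
             (if ⌊ y ℤ.≟ x ⌋ then false
              else if ⌊ y ℤ.≟ x ℤ.- + p ⌋ then true
              else bead λs y)))

-- γ is a p-core: no rim p-hook can be removed (no bead with a gap p above it).
IsCore : ℕ → List ℕ → Set
IsCore p γ = ∀ x → bead γ x ≡ true → bead γ (x ℤ.- + p) ≡ true

HasCore : ℕ → List ℕ → List ℕ → Set
HasCore p λs γ = Star (λ a b → IsPartition b × PHookRemoval p a b) λs γ × IsCore p γ

InBlock : ℕ → List ℕ → ℕ → List ℕ → Set
InBlock p γ n μs = IsPartition μs × size μs ≡ n × HasCore p μs γ

-- ρ 0 < ρ 1 < … < ρ (p-1) are the positions of the lowest bead on each runner of γ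
-- (a bead of γ with no bead p below it; for a core this is the lowest one).
LowestBeads : ℕ → List ℕ → (ℕ → ℤ) → Set
LowestBeads p γ ρ =
  (∀ k → k < p → bead γ (ρ k) ≡ true × bead γ (ρ k ℤ.+ + p) ≡ false) ×
  (∀ a b → a < b → b < p → ρ a ℤ.< ρ b)

-- μ = ⟨i,j⟩: abacus of γ with the beads at ρ i and ρ j each moved down one position.
IsPair : ℕ → List ℕ → (ℕ → ℤ) → ℕ → ℕ → List ℕ → Set
IsPair p γ ρ i j μs =
  ∀ y → bead μs y ≡
    (if ⌊ y ℤ.≟ ρ i ⌋ ∨ ⌊ y ℤ.≟ ρ j ⌋ then false
     else if ⌊ y ℤ.≟ ρ i ℤ.+ + p ⌋ ∨ ⌊ y ℤ.≟ ρ j ℤ.+ + p ⌋ then true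
     else bead γ y)

{-# OPTIONS --safe #-}
module Submission where

-- On the abacus, conjugation is the reflection x ↦ -1 - x exchanging beads and gaps, so a
-- partition is self-conjugate exactly when its abacus is antisymmetric under it. A partition
-- of weight two over the core γ arises from γ by sliding beads one step down their runners
-- twice. For self-conjugate γ the map y ↦ -1 - p - y permutes the lowest beads ρ 0 < … < ρ (p - 1)
-- reversing their order, so ρ r + ρ (p - 1 - r) = -1 - p. Antisymmetry of μ forces the two slid
-- beads to be exchanged by this map: sliding one bead twice, or sliding a bead into the gap
-- just vacated, would give 2y = -1. Hence μ = ⟨i, p - 1 - i⟩ with i ≠ (p - 1)/2, and conversely
-- every such pair is self-conjugate.

open import Defs
open import Data.Bool using (Bool; true; false; if_then_else_; _∨_; _∧_; not)
open import Data.Bool.ListAction using (any)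
open import Data.Bool.Properties using (∨-identityʳ; ∨-assoc; ∨-comm; ∧-identityʳ; ∧-zeroʳ; ∨-abs-∧; not-involutive)
open import Data.Empty using (⊥)
open import Data.Fin using (Fin; toℕ; fromℕ<; punchOut)
import Data.Fin.Properties as FinP
open import Data.Integer as ℤ using (ℤ; +_; -_; -[1+_]; ∣_∣)
open import Data.Integer.DivMod using (_%ℕ_; _/ℕ_; a≡a%ℕn+[a/ℕn]*n; n%ℕd<d)
import Data.Integer.Properties as ℤP
open import Algebra.Properties.AbelianGroup ℤP.+-0-abelianGroup using (∙-cancelˡ; ∙-cancelʳ)
open import Data.Integer.Tactic.RingSolver using (solve-∀)
open import Data.List using (List; []; _∷_; length; map; filter; upTo; applyUpTo; _++_; replicate)
import Data.List.Properties as ListP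
open import Data.List.Relation.Unary.All as All using (All; []; _∷_)
open import Data.List.Relation.Unary.All.Properties using (applyUpTo⁺₁; ++⁺; replicate⁺)
open import Data.List.Relation.Unary.Linked as Linked using (Linked; []; [-]; _∷_)
open import Data.List.Relation.Unary.Linked.Properties using (Linked⇒All; applyUpTo⁺₂)
open import Data.Nat as ℕ using (ℕ; zero; suc; _∸_; z≤n; s≤s)
open import Data.Nat.ListAction using (sum)
import Data.Nat.ListAction.Properties as SumP
import Data.Nat.Properties as ℕP
open import Data.Product using (_×_; _,_; ∃-syntax; proj₁; proj₂)
open import Data.Sum using (_⊎_; inj₁; inj₂; [_,_]′)
open import Function using (_∘_; _⇔_; mk⇔; Equivalence)
open import Relation.Binary.Construct.Closure.ReflexiveTransitive using (Star; ε; _◅_)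
open import Relation.Binary.Definitions using (tri<; tri≈; tri>)
open import Relation.Binary.PropositionalEquality
open import Relation.Nullary using (Dec; yes; no; ¬_; contradiction)
open import Relation.Nullary.Decidable using (⌊_⌋)

module _ where

  open import Data.Integer using (_+_; _-_; _*_)

  ⌊⌋-true : {A : Set} (a? : Dec A) → A → ⌊ a? ⌋ ≡ true
  ⌊⌋-true (yes _) _ = refl
  ⌊⌋-true (no ¬a) a = contradiction a ¬a

  ⌊⌋-false : {A : Set} (a? : Dec A) → ¬ A → ⌊ a? ⌋ ≡ false
  ⌊⌋-false (yes a) ¬a = contradiction a ¬a
  ⌊⌋-false (no _) _ = refl

  ⌊⌋-⇔ : {A B : Set} → A ⇔ B → (a? : Dec A) (b? : Dec B) → ⌊ a? ⌋ ≡ ⌊ b? ⌋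
  ⌊⌋-⇔ A⇔B a? (yes b) = ⌊⌋-true a? (Equivalence.from A⇔B b)
  ⌊⌋-⇔ A⇔B a? (no ¬b) = ⌊⌋-false a? (¬b ∘ Equivalence.to A⇔B)

  ⌊⌋-⊎ : {A B C : Set} → A ⇔ (B ⊎ C) → (a? : Dec A) (b? : Dec B) (c? : Dec C) → ⌊ a? ⌋ ≡ (⌊ b? ⌋ ∨ ⌊ c? ⌋)
  ⌊⌋-⊎ A⇔B⊎C a? (yes b) c? = ⌊⌋-true a? (Equivalence.from A⇔B⊎C (inj₁ b))
  ⌊⌋-⊎ A⇔B⊎C a? (no ¬b) (yes c) = ⌊⌋-true a? (Equivalence.from A⇔B⊎C (inj₂ c))
  ⌊⌋-⊎ A⇔B⊎C a? (no ¬b) (no ¬c) = ⌊⌋-false a? λ a → [ ¬b , ¬c ]′ (Equivalence.to A⇔B⊎C a)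

  ∨-leftSwap : (a b c : Bool) → (a ∨ (b ∨ c)) ≡ (b ∨ (a ∨ c))
  ∨-leftSwap a b c = trans (sym (∨-assoc a b c)) (trans (cong (_∨ c) (∨-comm a b)) (∨-assoc b a c))

  ≟-diag : (x : ℤ) → ⌊ x ℤ.≟ x ⌋ ≡ true
  ≟-diag x = ⌊⌋-true (x ℤ.≟ x) refl

  ≟-≢ : {x y : ℤ} → x ≢ y → ⌊ x ℤ.≟ y ⌋ ≡ false
  ≟-≢ = ⌊⌋-false (_ ℤ.≟ _)

  +-cancelʳ-≡ : (d : ℤ) {x y : ℤ} → x + d ≡ y + d → x ≡ y
  +-cancelʳ-≡ d = ∙-cancelʳ d _ _

  +-cancelˡ-≡ : (d : ℤ) {x y : ℤ} → d + x ≡ d + y → x ≡ y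
  +-cancelˡ-≡ d = ∙-cancelˡ d _ _

  +-cancelʳ-< : (d : ℤ) {x y : ℤ} → x + d ℤ.< y + d → x ℤ.< y
  +-cancelʳ-< d {x} {y} x+d<y+d = subst₂ ℤ._<_ (+-neg x d) (+-neg y d) (ℤP.+-monoˡ-< (- d) x+d<y+d)
    where
    +-neg : ∀ z d → z + d + - d ≡ z
    +-neg = solve-∀

  ≟-+ : (d x y : ℤ) → ⌊ x ℤ.≟ y ⌋ ≡ ⌊ x + d ℤ.≟ y + d ⌋
  ≟-+ d x y = ⌊⌋-⇔ (mk⇔ (cong (_+ d)) (+-cancelʳ-≡ d)) (x ℤ.≟ y) (x + d ℤ.≟ y + d)

  <?-+ : (d x y : ℤ) → ⌊ x ℤ.<? y ⌋ ≡ ⌊ x + d ℤ.<? y + d ⌋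
  <?-+ d x y = ⌊⌋-⇔ (mk⇔ (ℤP.+-monoˡ-< d) (+-cancelʳ-< d)) (x ℤ.<? y) (x + d ℤ.<? y + d)

  pred-+1 : (c : ℤ) → ℤ.pred (c + + 1) ≡ c
  pred-+1 c = trans (cong ℤ.pred (ℤP.+-comm c (+ 1))) (ℤP.pred-suc c)

  <-+1⇔≡⊎< : {x c : ℤ} → x ℤ.< c + + 1 ⇔ (x ≡ c ⊎ x ℤ.< c)
  <-+1⇔≡⊎< {x} {c} = mk⇔ to from
    where
    to : x ℤ.< c + + 1 → x ≡ c ⊎ x ℤ.< c
    to x<c+1 with x ℤ.≟ c
    ... | yes x≡c = inj₁ x≡c
    ... | no x≢c = inj₂ (ℤP.≤∧≢⇒< (subst (x ℤ.≤_) (pred-+1 c) (ℤP.i<j⇒i≤pred[j] x<c+1)) x≢c)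
    c<c+1 : c ℤ.< c + + 1
    c<c+1 = ℤP.i≤pred[j]⇒i<j (ℤP.≤-reflexive (sym (pred-+1 c)))
    from : x ≡ c ⊎ x ℤ.< c → x ℤ.< c + + 1
    from (inj₁ refl) = c<c+1
    from (inj₂ x<c) = ℤP.<-trans x<c c<c+1

  <?-+1 : (x c : ℤ) → ⌊ x ℤ.<? c + + 1 ⌋ ≡ (⌊ x ℤ.≟ c ⌋ ∨ ⌊ x ℤ.<? c ⌋)
  <?-+1 x c = ⌊⌋-⊎ <-+1⇔≡⊎< (x ℤ.<? c + + 1) (x ℤ.≟ c) (x ℤ.<? c)

  -1≡pred : (x : ℤ) → x - + 1 ≡ ℤ.pred x
  -1≡pred x = ℤP.+-comm x (- + 1)

  -1< : (x : ℤ) → x - + 1 ℤ.< x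
  -1< x = subst (ℤ._< x) (sym (-1≡pred x)) (ℤP.i≤pred[j]⇒i<j ℤP.≤-refl)

  <⇒≤-1 : {c b : ℕ} → c ℕ.< b → + c ℤ.≤ + b - + 1
  <⇒≤-1 {b = b} c<b = subst (_ ℤ.≤_) (sym (-1≡pred (+ b))) (ℤP.i<j⇒i≤pred[j] (ℤ.+<+ c<b))

  ≤⇒≡+ : {i j : ℤ} → i ℤ.≤ j → ∃[ m ] (j ≡ i + + m)
  ≤⇒≡+ {i} {j} i≤j = ∣ i - j ∣ , trans (split i j) (cong (_+_ i) (sym (ℤP.∣-∣-≤ i≤j)))
    where
    split : ∀ i j → j ≡ i + (j - i)
    split = solve-∀

  ∣∣≤⇒≤ : {B : ℕ} (x : ℤ) → ∣ x ∣ ℕ.≤ B → x ℤ.≤ + B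
  ∣∣≤⇒≤ (+ n) n≤B = ℤ.+≤+ n≤B
  ∣∣≤⇒≤ -[1+ n ] _ = ℤ.-≤+

  ∣∣≤⇒-≤ : {B : ℕ} (x : ℤ) → ∣ x ∣ ℕ.≤ B → - + B ℤ.≤ x
  ∣∣≤⇒-≤ (+ n) _ = ℤP.≤-trans (ℤP.neg-mono-≤ (ℤ.+≤+ z≤n)) (ℤ.+≤+ z≤n)
  ∣∣≤⇒-≤ -[1+ n ] 1+n≤B = ℤP.neg-mono-≤ (ℤ.+≤+ 1+n≤B)

  x<x+suc : (x : ℤ) (q : ℕ) → x ℤ.< x + + suc q
  x<x+suc x q = subst (ℤ._< x + + suc q) (ℤP.+-identityʳ x) (ℤP.+-monoʳ-< x (ℤ.+<+ (s≤s z≤n)))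

  x-suc<x : (x : ℤ) (q : ℕ) → x - + suc q ℤ.< x
  x-suc<x x q = subst (x - + suc q ℤ.<_) (-+ x (+ suc q)) (x<x+suc (x - + suc q) q)
    where
    -+ : ∀ x p → x - p + p ≡ x
    -+ = solve-∀

  double≢-1 : (w : ℤ) → w + w ≢ - + 1
  double≢-1 (+ n) ()
  double≢-1 -[1+ n ] ()

  double-injective : {x y : ℤ} → x + x ≡ y + y → x ≡ y
  double-injective {x} {y} e with ℤP.<-cmp x y
  ... | tri< x<y _ _ = contradiction e (ℤP.<⇒≢ (ℤP.+-mono-< x<y x<y))
  ... | tri≈ _ x≡y _ = x≡y
  ... | tri> _ _ y<x = contradiction (sym e) (ℤP.<⇒≢ (ℤP.+-mono-< y<x y<x))

  <0-reflect : (y : ℤ) → ⌊ y ℤ.<? + 0 ⌋ ≡ not ⌊ - + 1 - y ℤ.<? + 0 ⌋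
  <0-reflect (+ zero) = refl
  <0-reflect (+ suc n) = refl
  <0-reflect -[1+ n ] = refl

  reflect-involutive : ∀ x → - + 1 - (- + 1 - x) ≡ x
  reflect-involutive = solve-∀

  ≟-reflect : (y t : ℤ) → ⌊ - + 1 - y ℤ.≟ t ⌋ ≡ ⌊ y ℤ.≟ - + 1 - t ⌋
  ≟-reflect y t = ⌊⌋-⇔ (mk⇔ (λ e → trans (sym (reflect-involutive y)) (cong (λ z → - + 1 - z) e))
                             (λ e → trans (cong (λ z → - + 1 - z) e) (reflect-involutive t)))
                        (- + 1 - y ℤ.≟ t) (y ℤ.≟ - + 1 - t)

  applyUpTo-cong : {A : Set} (f g : ℕ → A) (n : ℕ) → (∀ {i} → i ℕ.< n → f i ≡ g i) → applyUpTo f n ≡ applyUpTo g n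
  applyUpTo-cong f g zero _ = refl
  applyUpTo-cong f g (suc n) f≡g = cong₂ _∷_ (f≡g (s≤s z≤n)) (applyUpTo-cong (f ∘ suc) (g ∘ suc) n (f≡g ∘ s≤s))

  applyUpTo-+ : {A : Set} (f : ℕ → A) (m n : ℕ) → applyUpTo f (m ℕ.+ n) ≡ applyUpTo f m ++ applyUpTo (f ∘ (m ℕ.+_)) n
  applyUpTo-+ f zero n = refl
  applyUpTo-+ f (suc m) n = cong (f 0 ∷_) (applyUpTo-+ (f ∘ suc) m n)

  applyUpTo-replicate : {A : Set} (f : ℕ → A) (n : ℕ) (x : A) → (∀ {i} → i ℕ.< n → f i ≡ x) → applyUpTo f n ≡ replicate n x
  applyUpTo-replicate f zero x _ = refl
  applyUpTo-replicate f (suc n) x f≡x = cong₂ _∷_ (f≡x (s≤s z≤n)) (applyUpTo-replicate (f ∘ suc) n x (f≡x ∘ s≤s))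

  Linked-replicate-0 : (z : ℕ) → Linked ℕ._≥_ (replicate z 0)
  Linked-replicate-0 zero = []
  Linked-replicate-0 (suc zero) = [-]
  Linked-replicate-0 (suc (suc z)) = z≤n ∷ Linked-replicate-0 (suc z)

  Linked-++-replicate-0 : (z : ℕ) {ℓ : List ℕ} → Linked ℕ._≥_ ℓ → Linked ℕ._≥_ (ℓ ++ replicate z 0)
  Linked-++-replicate-0 z [] = Linked-replicate-0 z
  Linked-++-replicate-0 zero [-] = [-]
  Linked-++-replicate-0 (suc z) [-] = z≤n ∷ Linked-replicate-0 (suc z)
  Linked-++-replicate-0 z (a≥b ∷ l) = a≥b ∷ Linked-++-replicate-0 z l

  firstPart-tail : {a : ℕ} {as : List ℕ} → Linked ℕ._≥_ (a ∷ as) → firstPart as ℕ.≤ a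
  firstPart-tail [-] = z≤n
  firstPart-tail (a≥b ∷ _) = a≥b

  All-≤-firstPart : {ℓ : List ℕ} → Linked ℕ._≥_ ℓ → All (ℕ._≤ firstPart ℓ) ℓ
  All-≤-firstPart {[]} _ = []
  All-≤-firstPart {a ∷ as} l = Linked⇒All (λ x≥y y≥z → ℕP.≤-trans y≥z x≥y) ℕP.≤-refl l

  _∈ᵇ_ : ℤ → List ℤ → Bool
  x ∈ᵇ ys = any (λ y → ⌊ x ℤ.≟ y ⌋) ys

  ∈ᵇ-positionsFrom-suc : (x : ℤ) (i : ℕ) (ℓ : List ℕ) →
    x ∈ᵇ positionsFrom (suc i) ℓ ≡ (x + + 1) ∈ᵇ positionsFrom i ℓ
  ∈ᵇ-positionsFrom-suc x i [] = refl
  ∈ᵇ-positionsFrom-suc x i (a ∷ ℓ) =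
    cong₂ _∨_ (trans (≟-+ (+ 1) x _) (cong (λ z → ⌊ x + + 1 ℤ.≟ z ⌋) (shift (+ a) (+ i))))
              (∈ᵇ-positionsFrom-suc x (suc i) ℓ)
    where
    shift : ∀ a i → a - (+ 1 + i) + + 1 ≡ a - i
    shift = solve-∀

  bead-[] : (x : ℤ) → bead [] x ≡ ⌊ x ℤ.<? + 0 ⌋
  bead-[] x = ∨-identityʳ _

  bead-∷ : (a : ℕ) (as : List ℕ) (x : ℤ) → bead (a ∷ as) x ≡ (⌊ x ℤ.≟ + a - + 1 ⌋ ∨ bead as (x + + 1))
  bead-∷ a as x = begin
    B ∨ (A ∨ x ∈ᵇ positionsFrom 2 as)         ≡⟨ ∨-leftSwap B A _ ⟩
    A ∨ (B ∨ x ∈ᵇ positionsFrom 2 as)         ≡⟨ cong₂ (λ b c → A ∨ (b ∨ c)) below-shift (∈ᵇ-positionsFrom-suc x 1 as) ⟩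
    A ∨ bead as (x + + 1)                     ∎
    where
    open ≡-Reasoning
    A B : Bool
    A = ⌊ x ℤ.≟ + a - + 1 ⌋
    B = ⌊ x ℤ.<? - (+ suc (length as)) ⌋
    -1-shift : ∀ L → - (+ 1 + L) + + 1 ≡ - L
    -1-shift = solve-∀
    below-shift : B ≡ ⌊ x + + 1 ℤ.<? - (+ length as) ⌋
    below-shift = trans (<?-+ (+ 1) x _) (cong (λ c → ⌊ x + + 1 ℤ.<? c ⌋) (-1-shift (+ length as)))

  bead-0∷[] : (x : ℤ) → bead (0 ∷ []) x ≡ bead [] x
  bead-0∷[] x = begin
    bead (0 ∷ []) x                                 ≡⟨ bead-∷ 0 [] x ⟩
    ⌊ x ℤ.≟ - + 1 ⌋ ∨ bead [] (x + + 1)             ≡⟨ cong (⌊ x ℤ.≟ - + 1 ⌋ ∨_) (bead-[] (x + + 1)) ⟩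
    ⌊ x ℤ.≟ - + 1 ⌋ ∨ ⌊ x + + 1 ℤ.<? - + 1 + + 1 ⌋  ≡⟨ cong (⌊ x ℤ.≟ - + 1 ⌋ ∨_) (sym (<?-+ (+ 1) x (- + 1))) ⟩
    ⌊ x ℤ.≟ - + 1 ⌋ ∨ ⌊ x ℤ.<? - + 1 ⌋              ≡⟨ sym (<?-+1 x (- + 1)) ⟩
    ⌊ x ℤ.<? + 0 ⌋                                  ≡⟨ sym (bead-[] x) ⟩
    bead [] x                                       ∎
    where open ≡-Reasoning

  bead-replicate-0 : (z : ℕ) → bead (replicate z 0) ≗ bead []
  bead-replicate-0 zero x = refl
  bead-replicate-0 (suc z) x = begin
    bead (0 ∷ replicate z 0) x                     ≡⟨ bead-∷ 0 (replicate z 0) x ⟩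
    ⌊ x ℤ.≟ - + 1 ⌋ ∨ bead (replicate z 0) (x + + 1) ≡⟨ cong (⌊ x ℤ.≟ - + 1 ⌋ ∨_) (bead-replicate-0 z (x + + 1)) ⟩
    ⌊ x ℤ.≟ - + 1 ⌋ ∨ bead [] (x + + 1)            ≡⟨ sym (bead-∷ 0 [] x) ⟩
    bead (0 ∷ []) x                                ≡⟨ bead-0∷[] x ⟩
    bead [] x                                      ∎
    where open ≡-Reasoning

  bead-++-replicate-0 : (ℓ : List ℕ) (z : ℕ) → bead (ℓ ++ replicate z 0) ≗ bead ℓ
  bead-++-replicate-0 [] z x = bead-replicate-0 z x
  bead-++-replicate-0 (a ∷ ℓ) z x =
    trans (bead-∷ a (ℓ ++ replicate z 0) x)
          (trans (cong (⌊ x ℤ.≟ + a - + 1 ⌋ ∨_) (bead-++-replicate-0 ℓ z (x + + 1))) (sym (bead-∷ a ℓ x)))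

  bead-map-suc : (ν : List ℕ) (y : ℤ) →
    bead (map suc ν) y ≡ (if ⌊ y ℤ.≟ - (+ length ν) ⌋ then false else bead ν (y - + 1))
  bead-map-suc [] y with y ℤ.≟ + 0
  ... | yes refl = refl
  ... | no y≢0 = begin
    bead [] y                               ≡⟨ bead-[] y ⟩
    ⌊ y ℤ.<? + 0 ⌋                          ≡⟨ cong (_∨ ⌊ y ℤ.<? + 0 ⌋) (sym (≟-≢ y≢0)) ⟩
    ⌊ y ℤ.≟ + 0 ⌋ ∨ ⌊ y ℤ.<? + 0 ⌋          ≡⟨ sym (<?-+1 y (+ 0)) ⟩
    ⌊ y ℤ.<? + 1 ⌋                          ≡⟨ cong (λ z → ⌊ z ℤ.<? + 1 ⌋) (sym (-1+1 y)) ⟩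
    ⌊ y - + 1 + + 1 ℤ.<? + 0 + + 1 ⌋        ≡⟨ sym (<?-+ (+ 1) (y - + 1) (+ 0)) ⟩
    ⌊ y - + 1 ℤ.<? + 0 ⌋                    ≡⟨ sym (bead-[] (y - + 1)) ⟩
    bead [] (y - + 1)                       ∎
    where
    open ≡-Reasoning
    -1+1 : ∀ y → y - + 1 + + 1 ≡ y
    -1+1 = solve-∀
  bead-map-suc (a ∷ ν) y = trans (bead-∷ (suc a) (map suc ν) y)
    (trans (cong (⌊ y ℤ.≟ + a ⌋ ∨_) (bead-map-suc ν (y + + 1))) (split (y ℤ.≟ - (+ suc (length ν)))))
    where
    L : ℕ
    L = length ν
    shift-L : ∀ y L → y + + 1 ≡ - L → y ≡ - (+ 1 + L)
    shift-L y L e = trans (+1-1 y) (trans (cong (_- + 1) e) (neg-1 L))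
      where
      +1-1 : ∀ y → y ≡ y + + 1 - + 1
      +1-1 = solve-∀
      neg-1 : ∀ L → - L - + 1 ≡ - (+ 1 + L)
      neg-1 = solve-∀
    split : (d : Dec (y ≡ - (+ suc L))) →
      (⌊ y ℤ.≟ + a ⌋ ∨ (if ⌊ y + + 1 ℤ.≟ - (+ L) ⌋ then false else bead ν (y + + 1 - + 1)))
      ≡ (if ⌊ d ⌋ then false else bead (a ∷ ν) (y - + 1))
    split (yes refl) = cong (λ b → if b then false else bead ν (- (+ suc L) + + 1 - + 1))
      (trans (cong (λ z → ⌊ z ℤ.≟ - (+ L) ⌋) (-1+1 (+ L))) (≟-diag (- (+ L))))
      where
      -1+1 : ∀ L → - (+ 1 + L) + + 1 ≡ - L
      -1+1 = solve-∀
    split (no y≢) = begin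
      ⌊ y ℤ.≟ + a ⌋ ∨ (if ⌊ y + + 1 ℤ.≟ - (+ L) ⌋ then false else bead ν (y + + 1 - + 1))
        ≡⟨ cong (λ b → ⌊ y ℤ.≟ + a ⌋ ∨ (if b then false else bead ν (y + + 1 - + 1))) (≟-≢ (y≢ ∘ shift-L y (+ L))) ⟩
      ⌊ y ℤ.≟ + a ⌋ ∨ bead ν (y + + 1 - + 1)
        ≡⟨ cong₂ _∨_ (≟-+ (- + 1) y (+ a)) (cong (bead ν) (+1-1 y)) ⟩
      ⌊ y - + 1 ℤ.≟ + a - + 1 ⌋ ∨ bead ν (y - + 1 + + 1)
        ≡⟨ sym (bead-∷ a ν (y - + 1)) ⟩
      bead (a ∷ ν) (y - + 1) ∎
      where
      open ≡-Reasoning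
      +1-1 : ∀ y → y + + 1 - + 1 ≡ y - + 1 + + 1
      +1-1 = solve-∀

  bead-≥firstPart : (ℓ : List ℕ) → Linked ℕ._≥_ ℓ → (x : ℤ) → + firstPart ℓ ℤ.≤ x → bead ℓ x ≡ false
  bead-≥firstPart [] _ x 0≤x = trans (bead-[] x) (⌊⌋-false (x ℤ.<? + 0) (ℤP.≤⇒≯ 0≤x))
  bead-≥firstPart (a ∷ as) l x a≤x = trans (bead-∷ a as x)
    (cong₂ _∨_ (≟-≢ x≢a-1) (bead-≥firstPart as (Linked.tail l) (x + + 1) as≤x+1))
    where
    x≢a-1 : x ≢ + a - + 1
    x≢a-1 refl = ℤP.<-irrefl refl (ℤP.<-≤-trans (-1< (+ a)) a≤x)
    as≤x+1 : + firstPart as ℤ.≤ x + + 1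
    as≤x+1 = ℤP.≤-trans (ℤ.+≤+ (firstPart-tail l)) (ℤP.≤-trans a≤x (ℤP.i≤i+j x (+ 1)))

  bead-∷-last : (a : ℕ) (as : List ℕ) → bead (a ∷ as) (+ a - + 1) ≡ true
  bead-∷-last a as = trans (bead-∷ a as (+ a - + 1)) (cong (_∨ bead as (+ a - + 1 + + 1)) (≟-diag (+ a - + 1)))

  bead-∷-≢ : (a : ℕ) (as : List ℕ) {x : ℤ} → x ≢ + a → bead as x ≡ bead (a ∷ as) (x - + 1)
  bead-∷-≢ a as {x} x≢a = sym (trans (bead-∷ a as (x - + 1))
    (cong₂ _∨_ (≟-≢ (x≢a ∘ +-cancelʳ-≡ (- + 1))) (cong (bead as) (-1+1 x))))
    where
    -1+1 : ∀ x → x - + 1 + + 1 ≡ x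
    -1+1 = solve-∀

  firstPart-≤ : (ℓ m : List ℕ) → Linked ℕ._≥_ ℓ → All (0 ℕ.<_) m → bead m ≗ bead ℓ → firstPart m ℕ.≤ firstPart ℓ
  firstPart-≤ ℓ [] _ _ _ = z≤n
  firstPart-≤ ℓ (b ∷ bs) l _ m≗ℓ with ℕP.<-cmp (firstPart ℓ) b
  ... | tri< ℓ<b _ _ = contradiction
    (trans (sym (bead-∷-last b bs)) (trans (m≗ℓ _) (bead-≥firstPart ℓ l _ (<⇒≤-1 ℓ<b)))) λ ()
  ... | tri≈ _ ℓ≡b _ = ℕP.≤-reflexive (sym ℓ≡b)
  ... | tri> _ _ b<ℓ = ℕP.<⇒≤ b<ℓ

  bead-injective : (ℓ m : List ℕ) → IsPartition ℓ → IsPartition m → bead ℓ ≗ bead m → ℓ ≡ m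
  bead-injective [] [] _ _ _ = refl
  bead-injective [] (b ∷ bs) _ (pm@(0<b ∷ _) , _) ℓ≗m =
    contradiction (firstPart-≤ [] (b ∷ bs) [] pm (sym ∘ ℓ≗m)) (ℕP.<⇒≱ 0<b)
  bead-injective (a ∷ as) [] (pℓ@(0<a ∷ _) , _) _ ℓ≗m =
    contradiction (firstPart-≤ [] (a ∷ as) [] pℓ ℓ≗m) (ℕP.<⇒≱ 0<a)
  bead-injective (a ∷ as) (b ∷ bs) (0<a ∷ pas , lℓ) (0<b ∷ pbs , lm) ℓ≗m
    with ℕP.≤-antisym (firstPart-≤ (b ∷ bs) (a ∷ as) lm (0<a ∷ pas) ℓ≗m)
                      (firstPart-≤ (a ∷ as) (b ∷ bs) lℓ (0<b ∷ pbs) (sym ∘ ℓ≗m))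
  ... | refl = cong (a ∷_) (bead-injective as bs (pas , Linked.tail lℓ) (pbs , Linked.tail lm) tails)
    where
    tails : bead as ≗ bead bs
    tails x with x ℤ.≟ + a
    ... | yes refl = trans (bead-≥firstPart as (Linked.tail lℓ) x (ℤ.+≤+ (firstPart-tail lℓ)))
                      (sym (bead-≥firstPart bs (Linked.tail lm) x (ℤ.+≤+ (firstPart-tail lm))))
    ... | no x≢a = trans (bead-∷-≢ a as x≢a) (trans (ℓ≗m (x - + 1)) (sym (bead-∷-≢ a bs x≢a)))

  -- Conjugation

  partsAtLeast : ℕ → List ℕ → ℕ
  partsAtLeast j ℓ = length (filter (j ℕ.≤?_) ℓ)

  partsAtLeast-∷-≤ : {j a : ℕ} (ℓ : List ℕ) → j ℕ.≤ a → partsAtLeast j (a ∷ ℓ) ≡ suc (partsAtLeast j ℓ)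
  partsAtLeast-∷-≤ ℓ j≤a = cong length (ListP.filter-accept (_ ℕ.≤?_) j≤a)

  partsAtLeast-∷-≰ : {j a : ℕ} (ℓ : List ℕ) → ¬ j ℕ.≤ a → partsAtLeast j (a ∷ ℓ) ≡ partsAtLeast j ℓ
  partsAtLeast-∷-≰ ℓ j≰a = cong length (ListP.filter-reject (_ ℕ.≤?_) j≰a)

  partsAtLeast-antitone : {j j′ : ℕ} (ℓ : List ℕ) → j ℕ.≤ j′ → partsAtLeast j′ ℓ ℕ.≤ partsAtLeast j ℓ
  partsAtLeast-antitone [] _ = z≤n
  partsAtLeast-antitone {j} {j′} (a ∷ ℓ) j≤j′ with j′ ℕ.≤? a | j ℕ.≤? a
  ... | yes j′≤a | _ = subst₂ ℕ._≤_ (sym (partsAtLeast-∷-≤ ℓ j′≤a)) (sym (partsAtLeast-∷-≤ ℓ (ℕP.≤-trans j≤j′ j′≤a)))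
                                (s≤s (partsAtLeast-antitone ℓ j≤j′))
  ... | no j′≰a | yes j≤a = subst₂ ℕ._≤_ (sym (partsAtLeast-∷-≰ ℓ j′≰a)) (sym (partsAtLeast-∷-≤ ℓ j≤a))
                                (ℕP.m≤n⇒m≤1+n (partsAtLeast-antitone ℓ j≤j′))
  ... | no j′≰a | no j≰a = subst₂ ℕ._≤_ (sym (partsAtLeast-∷-≰ ℓ j′≰a)) (sym (partsAtLeast-∷-≰ ℓ j≰a)) (partsAtLeast-antitone ℓ j≤j′)

  partsAtLeast-> : {j h : ℕ} (ℓ : List ℕ) → All (ℕ._≤ h) ℓ → h ℕ.< j → partsAtLeast j ℓ ≡ 0
  partsAtLeast-> [] _ _ = refl
  partsAtLeast-> (a ∷ ℓ) (a≤h ∷ ℓ≤h) h<j = trans (partsAtLeast-∷-≰ ℓ (λ j≤a → ℕP.<-irrefl refl (ℕP.<-≤-trans h<j (ℕP.≤-trans j≤a a≤h))))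
                                        (partsAtLeast-> ℓ ℓ≤h h<j)

  conj-applyUpTo : (ℓ : List ℕ) → conj ℓ ≡ applyUpTo (λ j → partsAtLeast (suc j) ℓ) (firstPart ℓ)
  conj-applyUpTo ℓ = trans (sym (ListP.map-∘ (upTo (firstPart ℓ)))) (ListP.map-upTo (λ j → partsAtLeast (suc j) ℓ) (firstPart ℓ))

  conj-∷ : (a : ℕ) (as : List ℕ) → Linked ℕ._≥_ (a ∷ as) →
    conj (a ∷ as) ≡ map suc (conj as ++ replicate (a ∸ firstPart as) 0)
  conj-∷ a as l = begin
    conj (a ∷ as)                                                ≡⟨ conj-applyUpTo (a ∷ as) ⟩
    applyUpTo (λ j → partsAtLeast (suc j) (a ∷ as)) a                   ≡⟨ applyUpTo-cong _ _ a (partsAtLeast-∷-≤ as) ⟩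
    applyUpTo (suc ∘ c) a                                        ≡⟨ sym (ListP.map-applyUpTo c suc a) ⟩
    map suc (applyUpTo c a)                                      ≡⟨ cong (map suc ∘ applyUpTo c) (sym (ℕP.m+[n∸m]≡n h≤a)) ⟩
    map suc (applyUpTo c (h ℕ.+ (a ∸ h)))                        ≡⟨ cong (map suc) (applyUpTo-+ c h (a ∸ h)) ⟩
    map suc (applyUpTo c h ++ applyUpTo (c ∘ (h ℕ.+_)) (a ∸ h))  ≡⟨ cong (map suc) (cong₂ _++_ (sym (conj-applyUpTo as)) vanish) ⟩
    map suc (conj as ++ replicate (a ∸ h) 0)                     ∎
    where
    open ≡-Reasoning
    h : ℕ
    h = firstPart as
    c : ℕ → ℕ
    c j = partsAtLeast (suc j) as
    h≤a : h ℕ.≤ a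
    h≤a = firstPart-tail l
    vanish : applyUpTo (c ∘ (h ℕ.+_)) (a ∸ h) ≡ replicate (a ∸ h) 0
    vanish = applyUpTo-replicate _ (a ∸ h) 0
      (λ {i} _ → partsAtLeast-> as (All-≤-firstPart (Linked.tail l)) (s≤s (ℕP.m≤m+n h i)))

  length-conj : (ℓ : List ℕ) → length (conj ℓ) ≡ firstPart ℓ
  length-conj ℓ = trans (cong length (conj-applyUpTo ℓ)) (ListP.length-applyUpTo _ (firstPart ℓ))

  conj-isPartition : (ℓ : List ℕ) → IsPartition ℓ → IsPartition (conj ℓ)
  conj-isPartition ℓ _ = subst IsPartition (sym (conj-applyUpTo ℓ))
    (applyUpTo⁺₁ _ (firstPart ℓ) (positive ℓ) ,
     applyUpTo⁺₂ _ (firstPart ℓ) (λ i → partsAtLeast-antitone ℓ (ℕP.n≤1+n (suc i))))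
    where
    positive : (ℓ : List ℕ) {i : ℕ} → i ℕ.< firstPart ℓ → 0 ℕ.< partsAtLeast (suc i) ℓ
    positive (a ∷ as) i<a = subst (0 ℕ.<_) (sym (partsAtLeast-∷-≤ as i<a)) (s≤s z≤n)

  bead-conj : (ℓ : List ℕ) → Linked ℕ._≥_ ℓ → (y : ℤ) → bead (conj ℓ) y ≡ not (bead ℓ (- + 1 - y))
  bead-conj [] _ y = trans (bead-[] y) (trans (<0-reflect y) (cong not (sym (bead-[] (- + 1 - y)))))
  bead-conj (a ∷ as) l y = begin
    bead (conj (a ∷ as)) y                                     ≡⟨ cong (λ m → bead m y) (conj-∷ a as l) ⟩
    bead (map suc ν) y                                         ≡⟨ bead-map-suc ν y ⟩
    (if ⌊ y ℤ.≟ - (+ length ν) ⌋ then false else bead ν (y - + 1)) ≡⟨ cong (λ n → if ⌊ y ℤ.≟ - (+ n) ⌋ then false else bead ν (y - + 1)) length-ν ⟩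
    (if ⌊ y ℤ.≟ - (+ a) ⌋ then false else bead ν (y - + 1))    ≡⟨ split (y ℤ.≟ - (+ a)) ⟩
    not (bead (a ∷ as) (- + 1 - y))                            ∎
    where
    open ≡-Reasoning
    ν : List ℕ
    ν = conj as ++ replicate (a ∸ firstPart as) 0
    length-ν : length ν ≡ a
    length-ν = begin
      length ν                                                ≡⟨ ListP.length-++ (conj as) ⟩
      length (conj as) ℕ.+ length (replicate (a ∸ firstPart as) 0) ≡⟨ cong₂ ℕ._+_ (length-conj as) (ListP.length-replicate (a ∸ firstPart as)) ⟩
      firstPart as ℕ.+ (a ∸ firstPart as)                     ≡⟨ ℕP.m+[n∸m]≡n (firstPart-tail l) ⟩
      a                                                       ∎
    reflect-shift : ∀ y → - + 1 - (y - + 1) ≡ - + 1 - y + + 1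
    reflect-shift = solve-∀
    reflect-last : ∀ a → - + 1 - - a ≡ a - + 1
    reflect-last = solve-∀
    reflect-injective : ∀ y a → - + 1 - y ≡ a - + 1 → y ≡ - a
    reflect-injective y a e = trans (sym (reflect-involutive y)) (trans (cong (λ z → - + 1 - z) e) (reflect-last′ a))
      where
      reflect-last′ : ∀ a → - + 1 - (a - + 1) ≡ - a
      reflect-last′ = solve-∀
    split : (d : Dec (y ≡ - (+ a))) → (if ⌊ d ⌋ then false else bead ν (y - + 1)) ≡ not (bead (a ∷ as) (- + 1 - y))
    split (yes refl) = sym (cong not (trans (bead-∷ a as (- + 1 - - (+ a)))
      (cong (_∨ bead as (- + 1 - - (+ a) + + 1)) (trans (cong (λ z → ⌊ z ℤ.≟ + a - + 1 ⌋) (reflect-last (+ a))) (≟-diag _)))))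
    split (no y≢-a) = begin
      bead ν (y - + 1)                                        ≡⟨ bead-++-replicate-0 (conj as) (a ∸ firstPart as) (y - + 1) ⟩
      bead (conj as) (y - + 1)                                ≡⟨ bead-conj as (Linked.tail l) (y - + 1) ⟩
      not (bead as (- + 1 - (y - + 1)))                       ≡⟨ cong (not ∘ bead as) (reflect-shift y) ⟩
      not (bead as (- + 1 - y + + 1))                         ≡⟨ cong (λ b → not (b ∨ bead as (- + 1 - y + + 1))) (sym (≟-≢ (y≢-a ∘ reflect-injective y (+ a)))) ⟩
      not (⌊ - + 1 - y ℤ.≟ + a - + 1 ⌋ ∨ bead as (- + 1 - y + + 1)) ≡⟨ cong not (sym (bead-∷ a as (- + 1 - y))) ⟩
      not (bead (a ∷ as) (- + 1 - y))                         ∎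

  SelfDual : (ℤ → Bool) → Set
  SelfDual f = ∀ y → f y ≡ not (f (- + 1 - y))

  SelfDual-≗ : {f f′ : ℤ → Bool} → f ≗ f′ → SelfDual f → SelfDual f′
  SelfDual-≗ {f} {f′} f≗f′ dual y = trans (sym (f≗f′ y)) (trans (dual y) (cong not (f≗f′ (- + 1 - y))))

  SelfDual-reflect : {f : ℤ → Bool} → SelfDual f → ∀ y → f (- + 1 - y) ≡ not (f y)
  SelfDual-reflect {f} dual y = trans (sym (not-involutive _)) (cong not (sym (dual y)))

  selfConjugate⇒SelfDual : (ℓ : List ℕ) → IsPartition ℓ → conj ℓ ≡ ℓ → SelfDual (bead ℓ)
  selfConjugate⇒SelfDual ℓ (_ , l) conjℓ≡ℓ y = subst (λ m → bead m y ≡ not (bead ℓ (- + 1 - y))) conjℓ≡ℓ (bead-conj ℓ l y)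

  SelfDual⇒selfConjugate : (ℓ : List ℕ) → IsPartition ℓ → SelfDual (bead ℓ) → conj ℓ ≡ ℓ
  SelfDual⇒selfConjugate ℓ pℓ@(_ , l) dual =
    bead-injective (conj ℓ) ℓ (conj-isPartition ℓ pℓ) pℓ (λ y → trans (bead-conj ℓ l y) (sym (dual y)))

  -- PHookRemoval and IsPair unfold definitionally to move and move₂ below.
  move : (ℤ → Bool) → ℤ → ℤ → ℤ → Bool
  move f u v y = if ⌊ y ℤ.≟ u ⌋ then false else if ⌊ y ℤ.≟ v ⌋ then true else f y

  bead≢gap : (f : ℤ → Bool) {x y : ℤ} → f x ≡ true → f y ≡ false → x ≢ y
  bead≢gap f fx fy refl = contradiction (trans (sym fx) fy) λ ()

  move-cong : {f f′ : ℤ → Bool} (u v : ℤ) → f ≗ f′ → move f u v ≗ move f′ u v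
  move-cong u v f≗f′ y = cong (λ b → if ⌊ y ℤ.≟ u ⌋ then false else if ⌊ y ℤ.≟ v ⌋ then true else b) (f≗f′ y)

  move-source : (f : ℤ → Bool) (u v : ℤ) → move f u v u ≡ false
  move-source f u v = cong (λ b → if b then false else if ⌊ u ℤ.≟ v ⌋ then true else f u) (≟-diag u)

  move-target : (f : ℤ → Bool) {u v : ℤ} → v ≢ u → move f u v v ≡ true
  move-target f {u} {v} v≢u rewrite ≟-≢ v≢u | ≟-diag v = refl

  move-other : (f : ℤ → Bool) {u v y : ℤ} → y ≢ u → y ≢ v → move f u v y ≡ f y
  move-other f y≢u y≢v rewrite ≟-≢ y≢u | ≟-≢ y≢v = refl

  move-inverse : (f : ℤ → Bool) {u v : ℤ} → f u ≡ true → f v ≡ false → move (move f u v) v u ≗ f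
  move-inverse f {u} {v} fu fv y with y ℤ.≟ v | y ℤ.≟ u
  ... | yes refl | _ = sym fv
  ... | no _ | yes refl = sym fu
  ... | no _ | no _ = refl

  move-new-bead : (f : ℤ → Bool) {u v w : ℤ} → move f u v w ≡ true → f w ≡ false → w ≡ v
  move-new-bead f {u} {v} {w} moved fw with w ℤ.≟ u | w ℤ.≟ v
  ... | yes _ | _ = contradiction moved λ ()
  ... | no _ | yes w≡v = w≡v
  ... | no _ | no _ = contradiction (trans (sym moved) fw) λ ()

  move-new-gap : (f : ℤ → Bool) {u v w : ℤ} → move f u v w ≡ false → f w ≡ true → w ≡ u
  move-new-gap f {u} {v} {w} moved fw with w ℤ.≟ u | w ℤ.≟ v
  ... | yes w≡u | _ = w≡u
  ... | no _ | yes _ = contradiction moved λ ()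
  ... | no _ | no _ = contradiction (trans (sym fw) moved) λ ()

  move²-new-bead : (f : ℤ → Bool) {u₁ v₁ u₂ v₂ w : ℤ} →
    move (move f u₁ v₁) u₂ v₂ w ≡ true → f w ≡ false → w ≡ v₁ ⊎ w ≡ v₂
  move²-new-bead f {u₁} {v₁} {u₂} {v₂} {w} moved fw = split (move f u₁ v₁ w) refl
    where
    split : (b : Bool) → move f u₁ v₁ w ≡ b → w ≡ v₁ ⊎ w ≡ v₂
    split true eq = inj₁ (move-new-bead f eq fw)
    split false eq = inj₂ (move-new-bead (move f u₁ v₁) moved eq)

  move²-new-gap : (f : ℤ → Bool) {u₁ v₁ u₂ v₂ w : ℤ} →
    move (move f u₁ v₁) u₂ v₂ w ≡ false → f w ≡ true → w ≡ u₁ ⊎ w ≡ u₂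
  move²-new-gap f {u₁} {v₁} {u₂} {v₂} {w} moved fw = split (move f u₁ v₁ w) refl
    where
    split : (b : Bool) → move f u₁ v₁ w ≡ b → w ≡ u₁ ⊎ w ≡ u₂
    split false eq = inj₁ (move-new-gap f eq fw)
    split true eq = inj₂ (move-new-gap (move f u₁ v₁) moved eq)

  move₂ : (ℤ → Bool) → ℤ → ℤ → ℤ → ℤ → ℤ → Bool
  move₂ f a b c d y = if ⌊ y ℤ.≟ a ⌋ ∨ ⌊ y ℤ.≟ b ⌋ then false else if ⌊ y ℤ.≟ c ⌋ ∨ ⌊ y ℤ.≟ d ⌋ then true else f y

  move∘move≗move₂ : (f : ℤ → Bool) {a b c d : ℤ} → a ≢ b → a ≢ d → c ≢ d → move (move f a c) b d ≗ move₂ f a b c d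
  move∘move≗move₂ f {a} {b} {c} {d} a≢b a≢d c≢d y with y ℤ.≟ a | y ℤ.≟ b | y ℤ.≟ c | y ℤ.≟ d
  ... | yes refl | yes y≡b | _ | _ = contradiction y≡b a≢b
  ... | yes refl | no _ | _ | yes y≡d = contradiction y≡d a≢d
  ... | yes refl | no _ | _ | no _ = refl
  ... | no _ | yes _ | _ | _ = refl
  ... | no _ | no _ | yes refl | yes y≡d = contradiction y≡d c≢d
  ... | no _ | no _ | yes refl | no _ = refl
  ... | no _ | no _ | no _ | yes _ = refl
  ... | no _ | no _ | no _ | no _ = refl

  move₂-swap : (f : ℤ → Bool) (a b c d : ℤ) → move₂ f a b c d ≗ move₂ f b a d c
  move₂-swap f a b c d y = cong₂ (λ s t → if s then false else if t then true else f y)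
    (∨-comm ⌊ y ℤ.≟ a ⌋ ⌊ y ℤ.≟ b ⌋) (∨-comm ⌊ y ℤ.≟ c ⌋ ⌊ y ℤ.≟ d ⌋)

  move₂-selfDual : (f : ℤ → Bool) {a b : ℤ} → SelfDual f → f a ≡ true → f b ≡ true → a ≢ b →
    SelfDual (move₂ f a b (- + 1 - b) (- + 1 - a))
  move₂-selfDual f {a} {b} dual fa fb a≢b y =
    trans (cases (y ℤ.≟ a) (y ℤ.≟ b) (y ℤ.≟ c) (y ℤ.≟ d)) (cong not (sym reflected))
    where
    c = - + 1 - b
    d = - + 1 - a
    fc : f c ≡ false
    fc = trans (SelfDual-reflect dual b) (cong not fb)
    fd : f d ≡ false
    fd = trans (SelfDual-reflect dual a) (cong not fa)
    c≢d : c ≢ d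
    c≢d c≡d = a≢b (trans (sym (reflect-involutive a)) (trans (cong (λ z → - + 1 - z) (sym c≡d)) (reflect-involutive b)))
    reflected : move₂ f a b c d (- + 1 - y)
              ≡ (if ⌊ y ℤ.≟ d ⌋ ∨ ⌊ y ℤ.≟ c ⌋ then false else if ⌊ y ℤ.≟ b ⌋ ∨ ⌊ y ℤ.≟ a ⌋ then true else not (f y))
    reflected = trans
      (cong₂ (λ s t → if s then false else if t then true else f (- + 1 - y))
        (cong₂ _∨_ (≟-reflect y a) (≟-reflect y b))
        (cong₂ _∨_ (trans (≟-reflect y c) (cong (λ z → ⌊ y ℤ.≟ z ⌋) (reflect-involutive b)))
                   (trans (≟-reflect y d) (cong (λ z → ⌊ y ℤ.≟ z ⌋) (reflect-involutive a)))))
      (cong (λ r → if ⌊ y ℤ.≟ d ⌋ ∨ ⌊ y ℤ.≟ c ⌋ then false else if ⌊ y ℤ.≟ b ⌋ ∨ ⌊ y ℤ.≟ a ⌋ then true else r)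
        (SelfDual-reflect dual y))
    cases : (y≟a : Dec (y ≡ a)) (y≟b : Dec (y ≡ b)) (y≟c : Dec (y ≡ c)) (y≟d : Dec (y ≡ d)) →
      (if ⌊ y≟a ⌋ ∨ ⌊ y≟b ⌋ then false else if ⌊ y≟c ⌋ ∨ ⌊ y≟d ⌋ then true else f y)
      ≡ not (if ⌊ y≟d ⌋ ∨ ⌊ y≟c ⌋ then false else if ⌊ y≟b ⌋ ∨ ⌊ y≟a ⌋ then true else not (f y))
    cases (yes refl) (yes y≡b) _ _ = contradiction y≡b a≢b
    cases (yes refl) (no _) (yes y≡c) _ = contradiction y≡c (bead≢gap f fa fc)
    cases (yes refl) (no _) (no _) (yes y≡d) = contradiction y≡d (bead≢gap f fa fd)
    cases (yes refl) (no _) (no _) (no _) = refl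
    cases (no _) (yes refl) (yes y≡c) _ = contradiction y≡c (bead≢gap f fb fc)
    cases (no _) (yes refl) (no _) (yes y≡d) = contradiction y≡d (bead≢gap f fb fd)
    cases (no _) (yes refl) (no _) (no _) = refl
    cases (no _) (no _) (yes refl) (yes y≡d) = contradiction y≡d c≢d
    cases (no _) (no _) (yes refl) (no _) = refl
    cases (no _) (no _) (no _) (yes _) = refl
    cases (no _) (no _) (no _) (no _) = sym (not-involutive (f y))

  -- Sums over a window of positions

  windowSum : (ℤ → ℤ) → ℤ → ℕ → ℤ
  windowSum w lo zero = + 0
  windowSum w lo (suc K) = windowSum w lo K + w (lo + + K)

  InWindow : ℤ → ℕ → ℤ → Set
  InWindow lo K x = ∃[ t ] (t ℕ.< K × x ≡ lo + + t)

  _⇂_ : (ℤ → ℤ) → (ℤ → Bool) → ℤ → ℤ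
  (w ⇂ f) x = if f x then w x else + 0

  windowSum-cong : (w w′ : ℤ → ℤ) (lo : ℤ) (K : ℕ) → (∀ {t} → t ℕ.< K → w (lo + + t) ≡ w′ (lo + + t)) →
    windowSum w lo K ≡ windowSum w′ lo K
  windowSum-cong w w′ lo zero _ = refl
  windowSum-cong w w′ lo (suc K) w≡w′ = cong₂ _+_ (windowSum-cong w w′ lo K (w≡w′ ∘ ℕP.m≤n⇒m≤1+n)) (w≡w′ ℕP.≤-refl)

  windowSum-+ : (w w′ : ℤ → ℤ) (lo : ℤ) (K : ℕ) → windowSum (λ x → w x + w′ x) lo K ≡ windowSum w lo K + windowSum w′ lo K
  windowSum-+ w w′ lo zero = refl
  windowSum-+ w w′ lo (suc K) = trans (cong (_+ (w x + w′ x)) (windowSum-+ w w′ lo K)) (middle-swap (windowSum w lo K) (windowSum w′ lo K) (w x) (w′ x))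
    where
    x : ℤ
    x = lo + + K
    middle-swap : ∀ a b c d → a + b + (c + d) ≡ a + c + (b + d)
    middle-swap = solve-∀

  windowSum-zero : (w : ℤ → ℤ) (lo : ℤ) (K : ℕ) → (∀ {t} → t ℕ.< K → w (lo + + t) ≡ + 0) → windowSum w lo K ≡ + 0
  windowSum-zero w lo K w≡0 = trans (windowSum-cong w (λ _ → + 0) lo K w≡0) (vanish K)
    where
    vanish : ∀ K → windowSum (λ _ → + 0) lo K ≡ + 0
    vanish zero = refl
    vanish (suc K) = cong (_+ + 0) (vanish K)

  windowSum-point : (w : ℤ → ℤ) (lo : ℤ) (K : ℕ) {y : ℤ} → InWindow lo K y → windowSum (w ⇂ (λ x → ⌊ x ℤ.≟ y ⌋)) lo K ≡ w y
  windowSum-point w lo (suc K) (t , t<1+K , refl) with t ℕ.≟ K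
  ... | yes refl = trans (cong₂ _+_ (windowSum-zero _ lo t (λ s<t → cong (λ b → if b then _ else + 0) (≟-≢ (distinct s<t))))
                                   (cong (λ b → if b then w (lo + + t) else + 0) (≟-diag (lo + + t))))
                         (ℤP.+-identityˡ (w (lo + + t)))
    where
    distinct : ∀ {s} → s ℕ.< t → lo + + s ≢ lo + + t
    distinct s<t e = ℕP.<-irrefl (ℤP.+-injective (+-cancelˡ-≡ lo e)) s<t
  ... | no t≢K = trans (cong₂ _+_ (windowSum-point w lo K (t , ℕP.≤∧≢⇒< (ℕP.≤-pred t<1+K) t≢K , refl))
                                  (cong (λ b → if b then w (lo + + K) else + 0) (≟-≢ (t≢K ∘ sym ∘ ℤP.+-injective ∘ +-cancelˡ-≡ lo))))
                       (ℤP.+-identityʳ (w (lo + + t)))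

  listSum : (ℤ → ℤ) → List ℤ → ℤ
  listSum w [] = + 0
  listSum w (x ∷ xs) = w x + listSum w xs

  ∈ᵇ-> : {y : ℤ} (ys : List ℤ) → All (ℤ._< y) ys → y ∈ᵇ ys ≡ false
  ∈ᵇ-> [] [] = refl
  ∈ᵇ-> (z ∷ zs) (z<y ∷ zs<y) = cong₂ _∨_ (≟-≢ (λ y≡z → ℤP.<-irrefl (sym y≡z) z<y)) (∈ᵇ-> zs zs<y)

  windowSum-∈ᵇ : (w : ℤ → ℤ) (lo : ℤ) (K : ℕ) (xs : List ℤ) → Linked ℤ._>_ xs → All (InWindow lo K) xs →
    windowSum (w ⇂ (_∈ᵇ xs)) lo K ≡ listSum w xs
  windowSum-∈ᵇ w lo K [] _ _ = windowSum-zero _ lo K (λ _ → refl)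
  windowSum-∈ᵇ w lo K (y ∷ ys) l (y∈ ∷ ys∈) = begin
    windowSum (w ⇂ (_∈ᵇ (y ∷ ys))) lo K
      ≡⟨ windowSum-cong _ _ lo K (λ {t} _ → split (lo + + t)) ⟩
    windowSum (λ x → (w ⇂ (λ x → ⌊ x ℤ.≟ y ⌋)) x + (w ⇂ (_∈ᵇ ys)) x) lo K
      ≡⟨ windowSum-+ _ _ lo K ⟩
    windowSum (w ⇂ (λ x → ⌊ x ℤ.≟ y ⌋)) lo K + windowSum (w ⇂ (_∈ᵇ ys)) lo K
      ≡⟨ cong₂ _+_ (windowSum-point w lo K y∈) (windowSum-∈ᵇ w lo K ys (Linked.tail l) ys∈) ⟩
    w y + listSum w ys ∎
    where
    open ≡-Reasoning
    y∉ys : y ∈ᵇ ys ≡ false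
    y∉ys = ∈ᵇ-> ys (all-below l)
      where
      all-below : Linked ℤ._>_ (y ∷ ys) → All (ℤ._< y) ys
      all-below [-] = []
      all-below (y>z ∷ l′) = Linked⇒All (λ a>b b>c → ℤP.<-trans b>c a>b) y>z l′
    split : (x : ℤ) → (w ⇂ (_∈ᵇ (y ∷ ys))) x ≡ (w ⇂ (λ x → ⌊ x ℤ.≟ y ⌋)) x + (w ⇂ (_∈ᵇ ys)) x
    split x with x ℤ.≟ y
    ... | yes refl = sym (trans (cong (λ b → w x + (if b then w x else + 0)) y∉ys) (ℤP.+-identityʳ (w x)))
    ... | no _ = sym (ℤP.+-identityˡ _)

  windowSum-move : (w : ℤ → ℤ) (f : ℤ → Bool) (lo : ℤ) (K : ℕ) {u v : ℤ} → f u ≡ true → f v ≡ false →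
    InWindow lo K u → InWindow lo K v →
    windowSum (w ⇂ move f u v) lo K + w u ≡ windowSum (w ⇂ f) lo K + w v
  windowSum-move w f lo K {u} {v} fu fv u∈ v∈ = begin
    windowSum (w ⇂ move f u v) lo K + w u
      ≡⟨ cong (λ s → windowSum (w ⇂ move f u v) lo K + s) (sym (windowSum-point w lo K u∈)) ⟩
    windowSum (w ⇂ move f u v) lo K + windowSum (w ⇂ (λ x → ⌊ x ℤ.≟ u ⌋)) lo K
      ≡⟨ sym (windowSum-+ _ _ lo K) ⟩
    windowSum (λ x → (w ⇂ move f u v) x + (w ⇂ (λ x → ⌊ x ℤ.≟ u ⌋)) x) lo K
      ≡⟨ windowSum-cong _ _ lo K (λ {t} _ → exchange (lo + + t)) ⟩
    windowSum (λ x → (w ⇂ f) x + (w ⇂ (λ x → ⌊ x ℤ.≟ v ⌋)) x) lo K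
      ≡⟨ windowSum-+ _ _ lo K ⟩
    windowSum (w ⇂ f) lo K + windowSum (w ⇂ (λ x → ⌊ x ℤ.≟ v ⌋)) lo K
      ≡⟨ cong (λ s → windowSum (w ⇂ f) lo K + s) (windowSum-point w lo K v∈) ⟩
    windowSum (w ⇂ f) lo K + w v ∎
    where
    open ≡-Reasoning
    exchange : (x : ℤ) → (w ⇂ move f u v) x + (w ⇂ (λ x → ⌊ x ℤ.≟ u ⌋)) x ≡ (w ⇂ f) x + (w ⇂ (λ x → ⌊ x ℤ.≟ v ⌋)) x
    exchange x with x ℤ.≟ u | x ℤ.≟ v
    ... | yes refl | yes refl = contradiction (trans (sym fu) fv) λ ()
    ... | yes refl | no _ = trans (ℤP.+-identityˡ (w x)) (sym (trans (cong (λ b → (if b then w x else + 0) + + 0) fu) (ℤP.+-identityʳ (w x))))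
    ... | no _ | yes refl = trans (ℤP.+-identityʳ (w x)) (sym (trans (cong (λ b → (if b then w x else + 0) + w x) fv) (ℤP.+-identityˡ (w x))))
    ... | no _ | no _ = refl

  ballSum : (ℤ → ℤ) → ℕ → ℤ
  ballSum w B = windowSum w (- + B) (B ℕ.+ suc B)

  InBall : ℕ → ℤ → Set
  InBall B = InWindow (- + B) (B ℕ.+ suc B)

  ∣∣≤⇒InBall : (B : ℕ) {x : ℤ} → ∣ x ∣ ℕ.≤ B → InBall B x
  ∣∣≤⇒InBall B {+ n} n≤B = B ℕ.+ n , ℕP.+-monoʳ-< B (s≤s n≤B) , shift (+ B) (+ n)
    where
    shift : ∀ B n → n ≡ - B + (B + n)
    shift = solve-∀
  ∣∣≤⇒InBall B { -[1+ n ]} 1+n≤B = B ∸ suc n , ℕP.≤-<-trans (ℕP.m∸n≤m B (suc n)) (ℕP.m<m+n B (s≤s z≤n)) ,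
    trans (shift (+ n) (+ (B ∸ suc n))) (cong (λ m → - (+ m) + + (B ∸ suc n)) (ℕP.m+[n∸m]≡n 1+n≤B))
    where
    shift : ∀ n r → - (+ 1 + n) ≡ - (+ 1 + n + r) + r
    shift = solve-∀

  pad : ℕ → List ℕ → List ℕ
  pad B ℓ = ℓ ++ replicate (B ∸ length ℓ) 0

  length-pad : (B : ℕ) (ℓ : List ℕ) → length ℓ ℕ.≤ B → length (pad B ℓ) ≡ B
  length-pad B ℓ ℓ≤B = trans (ListP.length-++ ℓ)
    (trans (cong (length ℓ ℕ.+_) (ListP.length-replicate (B ∸ length ℓ))) (ℕP.m+[n∸m]≡n ℓ≤B))

  sum-pad : (B : ℕ) (ℓ : List ℕ) → sum (pad B ℓ) ≡ sum ℓ
  sum-pad B ℓ = trans (SumP.sum-++ ℓ _) (trans (cong (sum ℓ ℕ.+_) (zeros (B ∸ length ℓ))) (ℕP.+-identityʳ (sum ℓ)))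
    where
    zeros : ∀ z → sum (replicate z 0) ≡ 0
    zeros zero = refl
    zeros (suc z) = zeros z

  All-≤-pad : (B : ℕ) {ℓ : List ℕ} → Linked ℕ._≥_ ℓ → firstPart ℓ ℕ.≤ B → All (ℕ._≤ B) (pad B ℓ)
  All-≤-pad B l ℓ≤B = ++⁺ (All.map (λ a≤ → ℕP.≤-trans a≤ ℓ≤B) (All-≤-firstPart l)) (replicate⁺ _ z≤n)

  positionsFrom-decreasing : (i : ℕ) {ℓ : List ℕ} → Linked ℕ._≥_ ℓ → Linked ℤ._>_ (positionsFrom i ℓ)
  positionsFrom-decreasing i [] = []
  positionsFrom-decreasing i [-] = [-]
  positionsFrom-decreasing i {a ∷ b ∷ bs} (a≥b ∷ l) = step ∷ positionsFrom-decreasing (suc i) l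
    where
    step : + b - + suc i ℤ.< + a - + i
    step = ℤP.≤-<-trans (ℤP.+-monoˡ-≤ (- + suc i) (ℤ.+≤+ a≥b)) (subst (ℤ._< + a - + i) (-1-assoc (+ a) (+ i)) (-1< (+ a - + i)))
      where
      -1-assoc : ∀ a i → a - i - + 1 ≡ a - (+ 1 + i)
      -1-assoc = solve-∀

  positionsFrom-inBall : (B i : ℕ) (ℓ : List ℕ) → All (ℕ._≤ B) ℓ → i ℕ.+ length ℓ ℕ.≤ suc B →
    All (InBall B) (positionsFrom i ℓ)
  positionsFrom-inBall B i [] _ _ = []
  positionsFrom-inBall B i (a ∷ as) (a≤B ∷ as≤B) bound =
    (a ℕ.+ r , t<K , position) ∷ positionsFrom-inBall B (suc i) as as≤B (subst (ℕ._≤ suc B) (ℕP.+-suc i (length as)) bound)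
    where
    i≤B : i ℕ.≤ B
    i≤B = ℕP.≤-trans (ℕP.m≤m+n i (length as)) (ℕP.≤-pred (subst (ℕ._≤ suc B) (ℕP.+-suc i (length as)) bound))
    r : ℕ
    r = B ∸ i
    t<K : a ℕ.+ r ℕ.< B ℕ.+ suc B
    t<K = ℕP.≤-<-trans (ℕP.+-mono-≤ a≤B (ℕP.m∸n≤m B i)) (ℕP.+-monoʳ-< B ℕP.≤-refl)
    position : + a - + i ≡ - + B + + (a ℕ.+ r)
    position = trans (shift (+ a) (+ i) (+ r)) (cong (λ m → - (+ m) + + (a ℕ.+ r)) (ℕP.m+[n∸m]≡n i≤B))
      where
      shift : ∀ a i r → a - i ≡ - (i + r) + (a + r)
      shift = solve-∀

  ballSum-bead : (w : ℤ → ℤ) (B : ℕ) (ℓ : List ℕ) → Linked ℕ._≥_ ℓ → length ℓ ℕ.≤ B → firstPart ℓ ℕ.≤ B →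
    ballSum (w ⇂ bead ℓ) B ≡ listSum w (positionsFrom 1 (pad B ℓ))
  ballSum-bead w B ℓ l ℓ≤B first≤B =
    trans (windowSum-cong _ _ (- + B) (B ℕ.+ suc B) (λ {t} _ → cong (λ b → if b then w (- + B + + t) else + 0) (inside t)))
          (windowSum-∈ᵇ w (- + B) (B ℕ.+ suc B) (positionsFrom 1 (pad B ℓ))
             (positionsFrom-decreasing 1 (Linked-++-replicate-0 (B ∸ length ℓ) l))
             (positionsFrom-inBall B 1 (pad B ℓ) (All-≤-pad B l first≤B) (ℕP.≤-reflexive (cong suc (length-pad B ℓ ℓ≤B)))))
    where
    inside : ∀ t → bead ℓ (- + B + + t) ≡ (- + B + + t) ∈ᵇ positionsFrom 1 (pad B ℓ)
    inside t = trans (sym (bead-++-replicate-0 ℓ (B ∸ length ℓ) x))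
      (cong (_∨ x ∈ᵇ positionsFrom 1 (pad B ℓ))
        (trans (cong (λ n → ⌊ x ℤ.<? - (+ n) ⌋) (length-pad B ℓ ℓ≤B)) (⌊⌋-false (x ℤ.<? - + B) (ℤP.≤⇒≯ (ℤP.i≤i+j (- + B) (+ t))))))
      where
      x : ℤ
      x = - + B + + t

  indexSum : ℕ → ℕ → ℤ
  indexSum i zero = + 0
  indexSum i (suc n) = + i + indexSum (suc i) n

  listSum-positionsFrom : (i : ℕ) (ℓ : List ℕ) → listSum (λ x → x) (positionsFrom i ℓ) + indexSum i (length ℓ) ≡ + sum ℓ
  listSum-positionsFrom i [] = refl
  listSum-positionsFrom i (a ∷ as) =
    trans (regroup (+ a) (+ i) (listSum (λ x → x) (positionsFrom (suc i) as)) (indexSum (suc i) (length as)))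
          (cong (_+_ (+ a)) (listSum-positionsFrom (suc i) as))
    where
    regroup : ∀ a i s t → a - i + s + (i + t) ≡ a + (s + t)
    regroup = solve-∀

  listSum-1-positionsFrom : (i : ℕ) (ℓ : List ℕ) → listSum (λ _ → + 1) (positionsFrom i ℓ) ≡ + length ℓ
  listSum-1-positionsFrom i [] = refl
  listSum-1-positionsFrom i (a ∷ as) = cong (_+_ (+ 1)) (listSum-1-positionsFrom (suc i) as)

  ballSum-size : (B : ℕ) (ℓ : List ℕ) → Linked ℕ._≥_ ℓ → length ℓ ℕ.≤ B → firstPart ℓ ℕ.≤ B →
    ballSum ((λ x → x) ⇂ bead ℓ) B + indexSum 1 B ≡ + size ℓ
  ballSum-size B ℓ l ℓ≤B first≤B = begin
    ballSum ((λ x → x) ⇂ bead ℓ) B + indexSum 1 B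
      ≡⟨ cong₂ _+_ (ballSum-bead (λ x → x) B ℓ l ℓ≤B first≤B) (cong (indexSum 1) (sym (length-pad B ℓ ℓ≤B))) ⟩
    listSum (λ x → x) (positionsFrom 1 (pad B ℓ)) + indexSum 1 (length (pad B ℓ))
      ≡⟨ listSum-positionsFrom 1 (pad B ℓ) ⟩
    + sum (pad B ℓ)
      ≡⟨ cong +_ (sum-pad B ℓ) ⟩
    + size ℓ ∎
    where open ≡-Reasoning

  ballSum-count : (B : ℕ) (ℓ : List ℕ) → Linked ℕ._≥_ ℓ → length ℓ ℕ.≤ B → firstPart ℓ ℕ.≤ B →
    ballSum ((λ _ → + 1) ⇂ bead ℓ) B ≡ + B
  ballSum-count B ℓ l ℓ≤B first≤B =
    trans (ballSum-bead (λ _ → + 1) B ℓ l ℓ≤B first≤B)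
          (trans (listSum-1-positionsFrom 1 (pad B ℓ)) (cong +_ (length-pad B ℓ ℓ≤B)))

  radius : List ℕ → ℕ
  radius ℓ = length ℓ ℕ.+ firstPart ℓ

  length≤ : (ℓ : List ℕ) {B : ℕ} → radius ℓ ℕ.≤ B → length ℓ ℕ.≤ B
  length≤ ℓ = ℕP.≤-trans (ℕP.m≤m+n (length ℓ) (firstPart ℓ))

  firstPart≤ : (ℓ : List ℕ) {B : ℕ} → radius ℓ ℕ.≤ B → firstPart ℓ ℕ.≤ B
  firstPart≤ ℓ = ℕP.≤-trans (ℕP.m≤n+m (firstPart ℓ) (length ℓ))

  size-move : (a b : List ℕ) → IsPartition a → IsPartition b → {u v : ℤ} → bead a u ≡ true → bead a v ≡ false →
    bead b ≗ move (bead a) u v → + size b + u ≡ + size a + v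
  size-move a b (_ , la) (_ , lb) {u} {v} au av b≗ = begin
    + size b + u                                                ≡⟨ cong (_+ u) (sym (ballSum-size B b lb (length≤ b b≤B) (firstPart≤ b b≤B))) ⟩
    ballSum (id ⇂ bead b) B + I + u                             ≡⟨ swap (ballSum (id ⇂ bead b) B) I u ⟩
    ballSum (id ⇂ bead b) B + u + I                             ≡⟨ cong (λ s → s + u + I) (windowSum-cong (id ⇂ bead b) (id ⇂ move (bead a) u v) (- + B) (B ℕ.+ suc B)
                                                                     (λ {t} _ → cong (λ c → if c then - + B + + t else + 0) (b≗ (- + B + + t)))) ⟩
    ballSum (id ⇂ move (bead a) u v) B + u + I                  ≡⟨ cong (_+ I) (windowSum-move id (bead a) (- + B) (B ℕ.+ suc B) au av u∈ v∈) ⟩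
    ballSum (id ⇂ bead a) B + v + I                             ≡⟨ sym (swap (ballSum (id ⇂ bead a) B) I v) ⟩
    ballSum (id ⇂ bead a) B + I + v                             ≡⟨ cong (_+ v) (ballSum-size B a la (length≤ a a≤B) (firstPart≤ a a≤B)) ⟩
    + size a + v                                                ∎
    where
    open ≡-Reasoning
    id : ℤ → ℤ
    id x = x
    B : ℕ
    B = radius a ℕ.+ radius b ℕ.+ (∣ u ∣ ℕ.+ ∣ v ∣)
    I : ℤ
    I = indexSum 1 B
    a≤B : radius a ℕ.≤ B
    a≤B = ℕP.m≤n⇒m≤n+o (∣ u ∣ ℕ.+ ∣ v ∣) (ℕP.m≤m+n (radius a) (radius b))
    b≤B : radius b ℕ.≤ B
    b≤B = ℕP.m≤n⇒m≤n+o (∣ u ∣ ℕ.+ ∣ v ∣) (ℕP.m≤n+m (radius b) (radius a))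
    u∈ : InBall B u
    u∈ = ∣∣≤⇒InBall B (ℕP.m≤n⇒m≤o+n (radius a ℕ.+ radius b) (ℕP.m≤m+n ∣ u ∣ ∣ v ∣))
    v∈ : InBall B v
    v∈ = ∣∣≤⇒InBall B (ℕP.m≤n⇒m≤o+n (radius a ℕ.+ radius b) (ℕP.m≤n+m ∣ v ∣ ∣ u ∣))
    swap : ∀ x y z → x + y + z ≡ x + z + y
    swap = solve-∀

  -- Realising an abacus by a partition

  stripZeros : (ℓ : List ℕ) → Linked ℕ._≥_ ℓ → ∃[ ν ] ∃[ z ] (ℓ ≡ ν ++ replicate z 0 × IsPartition ν)
  stripZeros [] _ = [] , 0 , refl , [] , []
  stripZeros (a ∷ as) l with stripZeros as (Linked.tail l)
  stripZeros (zero ∷ _) l | [] , z , refl , _ = [] , suc z , refl , [] , []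
  stripZeros (zero ∷ _) l | c ∷ _ , _ , refl , 0<c ∷ _ , _ = contradiction (Linked.head l) (ℕP.<⇒≱ 0<c)
  stripZeros (suc a ∷ _) l | ν , z , refl , pν , lν = suc a ∷ ν , z , refl , s≤s z≤n ∷ pν , extend ν l lν
    where
    extend : (ν : List ℕ) → Linked ℕ._≥_ (suc a ∷ ν ++ replicate z 0) → Linked ℕ._≥_ ν → Linked ℕ._≥_ (suc a ∷ ν)
    extend [] _ _ = [-]
    extend (c ∷ _) l lν = Linked.head l ∷ lν

  -- Reading f upwards from -N, each bead becomes a part equal to the number of gaps below it.
  module Scan (f : ℤ → Bool) (N : ℕ) where

    lo : ℤ
    lo = - + N

    gaps : ℕ → ℕ
    gaps zero = 0
    gaps (suc k) = if f (lo + + k) then gaps k else suc (gaps k)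

    parts : ℕ → List ℕ
    parts zero = []
    parts (suc k) = if f (lo + + k) then gaps k ∷ parts k else parts k

    length-parts+gaps : ∀ k → length (parts k) ℕ.+ gaps k ≡ k
    length-parts+gaps zero = refl
    length-parts+gaps (suc k) with f (lo + + k)
    ... | true = cong suc (length-parts+gaps k)
    ... | false = trans (ℕP.+-suc (length (parts k)) (gaps k)) (cong suc (length-parts+gaps k))

    parts-decreasing : ∀ k → Linked ℕ._≥_ (parts k) × All (ℕ._≤ gaps k) (parts k)
    parts-decreasing zero = [] , []
    parts-decreasing (suc k) with f (lo + + k) | parts-decreasing k
    ... | true | l , ≤gaps = cons l ≤gaps , ℕP.≤-refl ∷ ≤gaps
      where
      cons : {ℓ : List ℕ} → Linked ℕ._≥_ ℓ → All (ℕ._≤ gaps k) ℓ → Linked ℕ._≥_ (gaps k ∷ ℓ)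
      cons [] [] = [-]
      cons l (a≤ ∷ _) = a≤ ∷ l
    ... | false | l , ≤gaps = l , All.map ℕP.m≤n⇒m≤1+n ≤gaps

    length-parts : ∀ k → + length (parts k) ≡ windowSum ((λ _ → + 1) ⇂ f) lo k
    length-parts zero = refl
    length-parts (suc k) with f (lo + + k)
    ... | true = trans (ℤP.+-comm (+ 1) (+ length (parts k))) (cong (_+ + 1) (length-parts k))
    ... | false = trans (sym (ℤP.+-identityʳ _)) (cong (_+ + 0) (length-parts k))

    truncated : ℕ → ℤ → Bool
    truncated k x = ⌊ x ℤ.<? lo ⌋ ∨ (⌊ x ℤ.<? lo + + k ⌋ ∧ f x)

    truncated-suc : ∀ k x → truncated (suc k) x ≡ ((⌊ x ℤ.≟ lo + + k ⌋ ∧ f (lo + + k)) ∨ truncated k x)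
    truncated-suc k x =
      trans (cong (λ b → ⌊ x ℤ.<? lo ⌋ ∨ (b ∧ f x))
                  (trans (cong (λ c → ⌊ x ℤ.<? c ⌋) (+1-assoc lo (+ k))) (<?-+1 x (lo + + k))))
            (rearrange (x ℤ.≟ lo + + k))
      where
      +1-assoc : ∀ lo k → lo + (+ 1 + k) ≡ lo + k + + 1
      +1-assoc = solve-∀
      rearrange : (d : Dec (x ≡ lo + + k)) →
        (⌊ x ℤ.<? lo ⌋ ∨ ((⌊ d ⌋ ∨ ⌊ x ℤ.<? lo + + k ⌋) ∧ f x)) ≡ ((⌊ d ⌋ ∧ f (lo + + k)) ∨ truncated k x)
      rearrange (yes refl)
        rewrite ⌊⌋-false (lo + + k ℤ.<? lo) (ℤP.≤⇒≯ (ℤP.i≤i+j lo (+ k)))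
              | ⌊⌋-false (lo + + k ℤ.<? lo + + k) (ℤP.<-irrefl refl) = sym (∨-identityʳ _)
      rearrange (no _) = refl

    beadsFrom : ℕ → List ℕ → ℤ → Bool
    beadsFrom i ℓ x = ⌊ x ℤ.<? lo ⌋ ∨ x ∈ᵇ positionsFrom i ℓ

    beadsFrom-parts : ∀ k i → i ℕ.+ length (parts k) ≡ suc N → beadsFrom i (parts k) ≗ truncated k
    beadsFrom-parts zero i _ x = trans (∨-identityʳ _)
      (sym (trans (cong (λ c → ⌊ x ℤ.<? lo ⌋ ∨ (⌊ x ℤ.<? c ⌋ ∧ f x)) (ℤP.+-identityʳ lo)) (∨-abs-∧ _ (f x))))
    beadsFrom-parts (suc k) i idx x = trans (step idx) (sym (truncated-suc k x))
      where
      step : i ℕ.+ length (parts (suc k)) ≡ suc N → beadsFrom i (parts (suc k)) x ≡ ((⌊ x ℤ.≟ lo + + k ⌋ ∧ f (lo + + k)) ∨ truncated k x)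
      step idx′ with f (lo + + k)
      ... | true = begin
        ⌊ x ℤ.<? lo ⌋ ∨ (⌊ x ℤ.≟ + gaps k - + i ⌋ ∨ x ∈ᵇ positionsFrom (suc i) (parts k))
          ≡⟨ ∨-leftSwap ⌊ x ℤ.<? lo ⌋ ⌊ x ℤ.≟ + gaps k - + i ⌋ (x ∈ᵇ positionsFrom (suc i) (parts k)) ⟩
        ⌊ x ℤ.≟ + gaps k - + i ⌋ ∨ beadsFrom (suc i) (parts k) x
          ≡⟨ cong₂ _∨_ (cong (λ c → ⌊ x ℤ.≟ c ⌋) position) (beadsFrom-parts k (suc i) (trans (sym (ℕP.+-suc i _)) idx′) x) ⟩
        ⌊ x ℤ.≟ lo + + k ⌋ ∨ truncated k x
          ≡⟨ cong (_∨ truncated k x) (sym (∧-identityʳ ⌊ x ℤ.≟ lo + + k ⌋)) ⟩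
        (⌊ x ℤ.≟ lo + + k ⌋ ∧ true) ∨ truncated k x ∎
        where
        open ≡-Reasoning
        i+L≡N : i ℕ.+ length (parts k) ≡ N
        i+L≡N = ℕP.suc-injective (trans (sym (ℕP.+-suc i _)) idx′)
        regroup : ∀ G i L → G - i ≡ - (i + L) + (L + G)
        regroup = solve-∀
        position : + gaps k - + i ≡ lo + + k
        position = trans (regroup (+ gaps k) (+ i) (+ length (parts k)))
                         (cong₂ (λ m n → - (+ m) + + n) i+L≡N (length-parts+gaps k))
      ... | false = trans (beadsFrom-parts k i idx′ x) (cong (_∨ truncated k x) (sym (∧-zeroʳ ⌊ x ℤ.≟ lo + + k ⌋)))

  realize : (f : ℤ → Bool) (B : ℕ) → (∀ x → x ℤ.< - + B → f x ≡ true) → (∀ x → + B ℤ.< x → f x ≡ false) →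
    ballSum ((λ _ → + 1) ⇂ f) B ≡ + B → ∃[ ν ] (IsPartition ν × bead ν ≗ f)
  realize f B below above counted = strip (stripZeros (parts K) (proj₁ (parts-decreasing K)))
    where
    open Scan f B
    K : ℕ
    K = B ℕ.+ suc B
    length≡B : length (parts K) ≡ B
    length≡B = ℤP.+-injective (trans (length-parts K) counted)
    end : lo + + K ≡ + suc B
    end = trans (cong (_+_ lo) (ℤP.pos-+ B (suc B))) (cancel (+ B) (+ suc B))
      where
      cancel : ∀ b c → - b + (b + c) ≡ c
      cancel = solve-∀
    beyond : (x : ℤ) → (x<lo? : Dec (x ℤ.< lo)) (x<end? : Dec (x ℤ.< lo + + K)) →
      (⌊ x<lo? ⌋ ∨ (⌊ x<end? ⌋ ∧ f x)) ≡ f x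
    beyond x (yes x<lo) _ = sym (below x x<lo)
    beyond x (no _) (yes _) = refl
    beyond x (no _) (no x≮end) = sym (above x (ℤP.suc[i]≤j⇒i<j (subst (ℤ._≤ x) end (ℤP.≮⇒≥ x≮end))))
    parts≗f : bead (parts K) ≗ f
    parts≗f x = begin
      bead (parts K) x       ≡⟨ cong (λ n → ⌊ x ℤ.<? - (+ n) ⌋ ∨ x ∈ᵇ positionsFrom 1 (parts K)) length≡B ⟩
      beadsFrom 1 (parts K) x ≡⟨ beadsFrom-parts K 1 (cong suc length≡B) x ⟩
      truncated K x          ≡⟨ beyond x (x ℤ.<? lo) (x ℤ.<? lo + + K) ⟩
      f x                    ∎
      where open ≡-Reasoning
    strip : ∃[ ν ] ∃[ z ] (parts K ≡ ν ++ replicate z 0 × IsPartition ν) → ∃[ ν ] (IsPartition ν × bead ν ≗ f)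
    strip (ν , z , parts≡ , pν) = ν , pν , λ x →
      trans (sym (bead-++-replicate-0 ν z x)) (trans (cong (λ m → bead m x) (sym parts≡)) (parts≗f x))

  realize-move : (λs : List ℕ) → IsPartition λs → {u v : ℤ} → bead λs u ≡ true → bead λs v ≡ false →
    ∃[ ν ] (IsPartition ν × bead ν ≗ move (bead λs) u v)
  realize-move λs (_ , l) {u} {v} λu λv = realize (move (bead λs) u v) B below above bead-count
    where
    B : ℕ
    B = radius λs ℕ.+ (∣ u ∣ ℕ.+ ∣ v ∣)
    u≤B : ∣ u ∣ ℕ.≤ B
    u≤B = ℕP.m≤n⇒m≤o+n (radius λs) (ℕP.m≤m+n ∣ u ∣ ∣ v ∣)
    v≤B : ∣ v ∣ ℕ.≤ B
    v≤B = ℕP.m≤n⇒m≤o+n (radius λs) (ℕP.m≤n+m ∣ v ∣ ∣ u ∣)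
    λ≤B : radius λs ℕ.≤ B
    λ≤B = ℕP.m≤m+n (radius λs) (∣ u ∣ ℕ.+ ∣ v ∣)
    unmoved-below : ∀ {x} → x ℤ.< - + B → move (bead λs) u v x ≡ bead λs x
    unmoved-below x<-B = move-other (bead λs)
      (λ x≡u → ℤP.<-irrefl x≡u (ℤP.<-≤-trans x<-B (∣∣≤⇒-≤ u u≤B)))
      (λ x≡v → ℤP.<-irrefl x≡v (ℤP.<-≤-trans x<-B (∣∣≤⇒-≤ v v≤B)))
    unmoved-above : ∀ {x} → + B ℤ.< x → move (bead λs) u v x ≡ bead λs x
    unmoved-above B<x = move-other (bead λs)
      (λ x≡u → ℤP.<-irrefl (sym x≡u) (ℤP.≤-<-trans (∣∣≤⇒≤ u u≤B) B<x))
      (λ x≡v → ℤP.<-irrefl (sym x≡v) (ℤP.≤-<-trans (∣∣≤⇒≤ v v≤B) B<x))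
    below : ∀ x → x ℤ.< - + B → move (bead λs) u v x ≡ true
    below x x<-B = trans (unmoved-below x<-B) (cong (_∨ x ∈ᵇ positionsFrom 1 λs)
      (⌊⌋-true (x ℤ.<? - + length λs) (ℤP.<-≤-trans x<-B (ℤP.neg-mono-≤ (ℤ.+≤+ (length≤ λs λ≤B))))))
    above : ∀ x → + B ℤ.< x → move (bead λs) u v x ≡ false
    above x B<x = trans (unmoved-above B<x)
      (bead-≥firstPart λs l x (ℤP.≤-trans (ℤ.+≤+ (firstPart≤ λs λ≤B)) (ℤP.<⇒≤ B<x)))
    bead-count : ballSum ((λ _ → + 1) ⇂ move (bead λs) u v) B ≡ + B
    bead-count = +-cancelʳ-≡ (+ 1) (trans (windowSum-move (λ _ → + 1) (bead λs) (- + B) (B ℕ.+ suc B) λu λv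
                                           (∣∣≤⇒InBall B u≤B) (∣∣≤⇒InBall B v≤B))
                                     (cong (_+ + 1) (ballSum-count B λs l (length≤ λs λ≤B) (firstPart≤ λs λ≤B))))

  -- Rim hooks

  HookStep : ℕ → List ℕ → List ℕ → Set
  HookStep p a b = IsPartition b × PHookRemoval p a b

  move⇒hookRemoval : (q : ℕ) {a b : List ℕ} {u : ℤ} → IsPartition b → bead b u ≡ true → bead b (u + + suc q) ≡ false →
    bead a ≗ move (bead b) u (u + + suc q) → HookStep (suc q) a b
  move⇒hookRemoval q {a} {b} {u} pb bu bu+p a≗ = pb , u + P ,
    trans (a≗ _) (move-target (bead b) (ℤP.<⇒≢ (x<x+suc u q) ∘ sym)) ,
    trans (cong (bead a) (+- u P)) (trans (a≗ u) (move-source (bead b) u _)) ,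
    λ y → sym (trans (cong (λ t → move (bead a) (u + P) t y) (+- u P))
                     (trans (move-cong _ u a≗ y) (move-inverse (bead b) bu bu+p y)))
    where
    P : ℤ
    P = + suc q
    +- : ∀ u P → u + P - P ≡ u
    +- = solve-∀

  hookStep⇒move : (q : ℕ) {a b : List ℕ} → HookStep (suc q) a b →
    ∃[ u ] (bead b u ≡ true × bead b (u + + suc q) ≡ false × bead a ≗ move (bead b) u (u + + suc q))
  hookStep⇒move q {a} {b} (_ , x , ax , ax-p , b≗) =
    x - P ,
    trans (b≗ (x - P)) (move-target (bead a) (ℤP.<⇒≢ (x-suc<x x q))) ,
    subst (λ t → bead b t ≡ false) x≡ (trans (b≗ x) (move-source (bead a) x (x - P))) ,
    λ y → subst (λ t → bead a y ≡ move (bead b) (x - P) t y) x≡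
                (sym (trans (move-cong (x - P) x b≗ y) (move-inverse (bead a) ax ax-p y)))
    where
    P : ℤ
    P = + suc q
    -+ : ∀ x P → x ≡ x - P + P
    -+ = solve-∀
    x≡ : x ≡ x - P + P
    x≡ = -+ x P

  hookRemoval-size : (p : ℕ) {a b : List ℕ} → IsPartition a → HookStep p a b → size a ≡ size b ℕ.+ p
  hookRemoval-size p {a} {b} pa (pb , x , ax , ax-p , b≗) = ℤP.+-injective (begin
    + size a                         ≡⟨ shift (+ size a) x (+ p) ⟩
    + size a + (x - + p) - x + + p   ≡⟨ cong (λ t → t - x + + p) (sym (size-move a b pa pb ax ax-p b≗)) ⟩
    + size b + x - x + + p           ≡⟨ cancel (+ size b) x (+ p) ⟩
    + size b + + p                   ≡⟨ sym (ℤP.pos-+ (size b) p) ⟩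
    + (size b ℕ.+ p)                 ∎)
    where
    open ≡-Reasoning
    shift : ∀ s x p → s ≡ s + (x - p) - x + p
    shift = solve-∀
    cancel : ∀ s x p → s + x - x + p ≡ s + p
    cancel = solve-∀

  core≤size : (p : ℕ) {a γ : List ℕ} → IsPartition a → Star (HookStep p) a γ → size γ ℕ.≤ size a
  core≤size p _ ε = ℕP.≤-refl
  core≤size p pa (step@(pb , _) ◅ steps) =
    ℕP.≤-trans (core≤size p pb steps) (ℕP.≤-trans (ℕP.m≤m+n _ p) (ℕP.≤-reflexive (sym (hookRemoval-size p pa step))))

  weight-two : (q : ℕ) {γ μ : List ℕ} {n : ℕ} → size γ ℕ.+ 2 ℕ.* suc q ≡ n → InBlock (suc q) γ n μ →
    ∃[ ν ] (HookStep (suc q) μ ν × HookStep (suc q) ν γ)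
  weight-two q {γ} size≡ (_ , size-μ , ε , _) = contradiction (trans size≡ (sym size-μ)) (ℕP.m+1+n≢m (size γ))
  weight-two q {γ} size≡ (pμ , size-μ , (s₁ ◅ ε) , _) =
    contradiction (ℕP.+-cancelˡ-≡ (size γ) _ _ (trans size≡ (trans (sym size-μ) (hookRemoval-size (suc q) pμ s₁))))
                  (ℕP.m+1+n≢m (suc q))
  weight-two q size≡ (_ , _ , (s₁ ◅ s₂ ◅ ε) , _) = _ , s₁ , s₂
  weight-two q {γ} {μ} size≡ (pμ , size-μ , (s₁@(pν₁ , _) ◅ s₂@(pν₂ , _) ◅ s₃@(pν₃ , _) ◅ steps) , _) =
    contradiction (subst (size γ ℕ.+ P ℕ.+ P ℕ.+ P ℕ.≤_) μ≡ three-hooks) (ℕP.m+1+n≰m (size γ ℕ.+ P ℕ.+ P))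
    where
    P : ℕ
    P = suc q
    μ≡ : size μ ≡ size γ ℕ.+ P ℕ.+ P
    μ≡ = trans size-μ (trans (sym size≡) (trans (cong (λ t → size γ ℕ.+ (P ℕ.+ t)) (ℕP.+-identityʳ P)) (sym (ℕP.+-assoc (size γ) P P))))
    three-hooks : size γ ℕ.+ P ℕ.+ P ℕ.+ P ℕ.≤ size μ
    three-hooks = subst (size γ ℕ.+ P ℕ.+ P ℕ.+ P ℕ.≤_)
      (sym (trans (hookRemoval-size P pμ s₁) (cong (ℕ._+ P) (trans (hookRemoval-size P pν₁ s₂) (cong (ℕ._+ P) (hookRemoval-size P pν₂ s₃))))))
      (ℕP.+-monoˡ-≤ P (ℕP.+-monoˡ-≤ P (ℕP.+-monoˡ-≤ P (core≤size P pν₃ steps))))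

  -- Runners of a self-conjugate core

  injective⇒surjective : (n : ℕ) (f : Fin n → Fin n) → (∀ {a b} → f a ≡ f b → a ≡ b) → ∀ c → ∃[ a ] (f a ≡ c)
  injective⇒surjective (suc m) f f-inj c with FinP.any? (λ a → f a FinP.≟ c)
  ... | yes hit = hit
  ... | no miss = contradiction (FinP.injective⇒≤ {f = skip-c} skip-c-injective) (ℕP.<-irrefl refl)
    where
    c≢f : ∀ a → c ≢ f a
    c≢f a c≡fa = miss (a , sym c≡fa)
    skip-c : Fin (suc m) → Fin m
    skip-c a = punchOut (c≢f a)
    skip-c-injective : ∀ {a b} → skip-c a ≡ skip-c b → a ≡ b
    skip-c-injective = f-inj ∘ FinP.punchOut-injective (c≢f _) (c≢f _)

  module Runners (q : ℕ) (γ : List ℕ) (ρ : ℕ → ℤ) (core : IsCore (suc q) γ) (dual : SelfDual (bead γ))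
                 (lowest : LowestBeads (suc q) γ ρ) where

    p : ℕ
    p = suc q

    P : ℤ
    P = + p

    IsLowest : ℤ → Set
    IsLowest y = bead γ y ≡ true × bead γ (y + P) ≡ false

    ρ-lowest : {a : ℕ} → a ℕ.< p → IsLowest (ρ a)
    ρ-lowest = proj₁ lowest _

    ρ-increasing : {a b : ℕ} → a ℕ.< b → b ℕ.< p → ρ a ℤ.< ρ b
    ρ-increasing = proj₂ lowest _ _

    ρ-injective : {a b : ℕ} → a ℕ.< p → b ℕ.< p → ρ a ≡ ρ b → a ≡ b
    ρ-injective {a} {b} a<p b<p ρa≡ρb with ℕP.<-cmp a b
    ... | tri< a<b _ _ = contradiction ρa≡ρb (ℤP.<⇒≢ (ρ-increasing a<b b<p))
    ... | tri≈ _ a≡b _ = a≡b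
    ... | tri> _ _ b<a = contradiction (sym ρa≡ρb) (ℤP.<⇒≢ (ρ-increasing b<a a<p))

    ρ-monotone : {a b : ℕ} → b ℕ.< p → a ℕ.≤ b → ρ a ℤ.≤ ρ b
    ρ-monotone b<p a≤b with ℕP.m≤n⇒m<n∨m≡n a≤b
    ... | inj₁ a<b = ℤP.<⇒≤ (ρ-increasing a<b b<p)
    ... | inj₂ refl = ℤP.≤-refl

    bead-up : (y : ℤ) (m : ℕ) → bead γ (y + + m * P) ≡ true → bead γ y ≡ true
    bead-up y zero = subst (λ t → bead γ t ≡ true) (+0* y P)
      where
      +0* : ∀ y P → y + + 0 * P ≡ y
      +0* = solve-∀
    bead-up y (suc m) bead-at = bead-up y m (subst (λ t → bead γ t ≡ true) (step y (+ m) P) (core _ bead-at))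
      where
      step : ∀ y m P → y + (+ 1 + m) * P - P ≡ y + m * P
      step = solve-∀

    lowest-not-below : {y y′ : ℤ} → IsLowest y → IsLowest y′ → y %ℕ p ≡ y′ %ℕ p → ¬ (y /ℕ p ℤ.< y′ /ℕ p)
    lowest-not-below {y} {y′} (_ , gap) (bead′ , _) same-runner y<y′ with ≤⇒≡+ (ℤP.i<j⇒suc[i]≤j y<y′)
    ... | m , level′ = contradiction (trans (sym (bead-up (y + P) m (subst (λ t → bead γ t ≡ true) y′≡ bead′))) gap) λ ()
      where
      regroup : ∀ r l m P → r + (+ 1 + l + m) * P ≡ r + l * P + P + m * P
      regroup = solve-∀
      y′≡ : y′ ≡ y + P + + m * P
      y′≡ = begin
        y′                                    ≡⟨ a≡a%ℕn+[a/ℕn]*n y′ p ⟩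
        + (y′ %ℕ p) + (y′ /ℕ p) * P           ≡⟨ cong₂ (λ r l → + r + l * P) (sym same-runner) level′ ⟩
        + (y %ℕ p) + (+ 1 + y /ℕ p + + m) * P ≡⟨ regroup (+ (y %ℕ p)) (y /ℕ p) (+ m) P ⟩
        + (y %ℕ p) + (y /ℕ p) * P + P + + m * P ≡⟨ cong (λ t → t + P + + m * P) (sym (a≡a%ℕn+[a/ℕn]*n y p)) ⟩
        y + P + + m * P                       ∎
        where open ≡-Reasoning

    lowest-unique : {y y′ : ℤ} → IsLowest y → IsLowest y′ → y %ℕ p ≡ y′ %ℕ p → y ≡ y′
    lowest-unique {y} {y′} ly ly′ same-runner with ℤP.<-cmp (y /ℕ p) (y′ /ℕ p)
    ... | tri< y<y′ _ _ = contradiction y<y′ (lowest-not-below ly ly′ same-runner)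
    ... | tri≈ _ same-level _ = trans (a≡a%ℕn+[a/ℕn]*n y p)
      (trans (cong₂ (λ r l → + r + l * P) same-runner same-level) (sym (a≡a%ℕn+[a/ℕn]*n y′ p)))
    ... | tri> _ _ y′<y = contradiction y′<y (lowest-not-below ly′ ly (sym same-runner))

    runner : ℤ → Fin p
    runner x = fromℕ< (n%ℕd<d x p)

    runner-≡ : (x y : ℤ) → runner x ≡ runner y → x %ℕ p ≡ y %ℕ p
    runner-≡ x y e = trans (sym (FinP.toℕ-fromℕ< (n%ℕd<d x p))) (trans (cong toℕ e) (FinP.toℕ-fromℕ< (n%ℕd<d y p)))

    lowest⇒ρ : {y : ℤ} → IsLowest y → ∃[ a ] (a ℕ.< p × ρ a ≡ y)
    lowest⇒ρ {y} ly with injective⇒surjective p (runner ∘ ρ ∘ toℕ) runner∘ρ-injective (runner y)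
      where
      runner∘ρ-injective : ∀ {a b} → runner (ρ (toℕ a)) ≡ runner (ρ (toℕ b)) → a ≡ b
      runner∘ρ-injective {a} {b} e = FinP.toℕ-injective (ρ-injective (FinP.toℕ<n a) (FinP.toℕ<n b)
        (lowest-unique (ρ-lowest (FinP.toℕ<n a)) (ρ-lowest (FinP.toℕ<n b)) (runner-≡ (ρ (toℕ a)) (ρ (toℕ b)) e)))
    ... | a , e = toℕ a , FinP.toℕ<n a , lowest-unique (ρ-lowest (FinP.toℕ<n a)) ly (runner-≡ (ρ (toℕ a)) y e)

    reflect-lowest : {y : ℤ} → IsLowest y → IsLowest (- + 1 - P - y)
    reflect-lowest {y} (bead-y , gap-y+P) = reflected-bead , reflected-gap
      where
      shift₁ : ∀ P y → - + 1 - (- + 1 - P - y) ≡ y + P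
      shift₁ = solve-∀
      shift₂ : ∀ P y → - + 1 - P - y + P ≡ - + 1 - y
      shift₂ = solve-∀
      reflected-bead : bead γ (- + 1 - P - y) ≡ true
      reflected-bead = trans (dual _) (cong not (trans (cong (bead γ) (shift₁ P y)) gap-y+P))
      reflected-gap : bead γ (- + 1 - P - y + P) ≡ false
      reflected-gap = trans (cong (bead γ) (shift₂ P y)) (trans (SelfDual-reflect dual y) (cong not bead-y))

    partner : ℕ → ℕ
    partner r with r ℕ.<? p
    ... | yes r<p = proj₁ (lowest⇒ρ (reflect-lowest (ρ-lowest r<p)))
    ... | no _ = 0  -- junk value, never used

    partner-spec : {r : ℕ} → r ℕ.< p → partner r ℕ.< p × ρ (partner r) ≡ - + 1 - P - ρ r
    partner-spec {r} r<p with r ℕ.<? p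
    ... | yes r<p′ = proj₂ (lowest⇒ρ (reflect-lowest (ρ-lowest r<p′)))
    ... | no r≮p = contradiction r<p r≮p

    partner-reversing : {r r′ : ℕ} → r ℕ.< r′ → r′ ℕ.< p → partner r′ ℕ.< partner r
    partner-reversing {r} {r′} r<r′ r′<p with partner r′ ℕ.<? partner r
    ... | yes σr′<σr = σr′<σr
    ... | no σr′≮σr = contradiction (ℤP.<-≤-trans reflected (ρ-monotone (proj₁ (partner-spec r′<p)) (ℕP.≮⇒≥ σr′≮σr)))
                                    (ℤP.<-irrefl refl)
      where
      reflect-< : ∀ a b → a ℤ.< b → - + 1 - P - b ℤ.< - + 1 - P - a
      reflect-< a b a<b = ℤP.+-monoʳ-< (- + 1 - P) (ℤP.neg-mono-< a<b)
      reflected : ρ (partner r′) ℤ.< ρ (partner r)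
      reflected = subst₂ ℤ._<_ (sym (proj₂ (partner-spec r′<p))) (sym (proj₂ (partner-spec (ℕP.<-trans r<r′ r′<p))))
                        (reflect-< _ _ (ρ-increasing r<r′ r′<p))

    partner+index<p : (r : ℕ) → r ℕ.< p → partner r ℕ.+ r ℕ.< p
    partner+index<p zero r<p = subst (ℕ._< p) (sym (ℕP.+-identityʳ _)) (proj₁ (partner-spec r<p))
    partner+index<p (suc r) r<p = ℕP.≤-<-trans (ℕP.≤-reflexive (ℕP.+-suc (partner (suc r)) r))
      (ℕP.≤-<-trans (ℕP.+-monoˡ-≤ r (partner-reversing ℕP.≤-refl r<p)) (partner+index<p r (ℕP.<-trans ℕP.≤-refl r<p)))

    q≤partner+index : (r d : ℕ) → r ℕ.+ d ≡ q → q ℕ.≤ partner r ℕ.+ r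
    q≤partner+index r zero r+0≡q = ℕP.≤-trans (ℕP.≤-reflexive (trans (sym r+0≡q) (ℕP.+-identityʳ r))) (ℕP.m≤n+m r _)
    q≤partner+index r (suc d) r+1+d≡q = ℕP.≤-trans (q≤partner+index (suc r) d (trans (sym (ℕP.+-suc r d)) r+1+d≡q))
      (ℕP.≤-trans (ℕP.≤-reflexive (ℕP.+-suc (partner (suc r)) r)) (ℕP.+-monoˡ-≤ r (partner-reversing ℕP.≤-refl 1+r<p)))
      where
      1+r<p : suc r ℕ.< p
      1+r<p = s≤s (ℕP.≤-trans (ℕP.m≤m+n (suc r) d) (ℕP.≤-reflexive (trans (sym (ℕP.+-suc r d)) r+1+d≡q)))

    ρ-pair : (r s : ℕ) → r ℕ.+ s ≡ q → ρ r + ρ s ≡ - + 1 - P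
    ρ-pair r s r+s≡q = begin
      ρ r + ρ s               ≡⟨ cong (λ t → ρ r + ρ t) (sym partner≡s) ⟩
      ρ r + ρ (partner r)     ≡⟨ cong (_+_ (ρ r)) (proj₂ (partner-spec r<p)) ⟩
      ρ r + (- + 1 - P - ρ r) ≡⟨ cancel (ρ r) P ⟩
      - + 1 - P               ∎
      where
      open ≡-Reasoning
      r<p : r ℕ.< p
      r<p = s≤s (ℕP.≤-trans (ℕP.m≤m+n r s) (ℕP.≤-reflexive r+s≡q))
      partner+r≡q : partner r ℕ.+ r ≡ q
      partner+r≡q = ℕP.≤-antisym (ℕP.≤-pred (partner+index<p r r<p)) (q≤partner+index r s r+s≡q)
      partner≡s : partner r ≡ s
      partner≡s = ℕP.+-cancelʳ-≡ r (partner r) s (trans partner+r≡q (trans (sym r+s≡q) (ℕP.+-comm r s)))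
      cancel : ∀ a P → a + (- + 1 - P - a) ≡ - + 1 - P
      cancel = solve-∀

  -- Self-conjugate partitions of weight two

  reflected-indices : (h k : ℕ) → 1 ℕ.≤ k → k ℕ.≤ h →
    h ∸ k ℕ.< h ℕ.+ k × h ℕ.+ k ℕ.< suc (h ℕ.+ h) × h ∸ k ℕ.+ (h ℕ.+ k) ≡ h ℕ.+ h
  reflected-indices h k 1≤k k≤h =
    ℕP.≤-<-trans (ℕP.m∸n≤m h k) (ℕP.m<m+n h 1≤k) ,
    s≤s (ℕP.+-monoʳ-≤ h k≤h) ,
    trans (sym (ℕP.+-assoc (h ∸ k) h k))
          (trans (cong (ℕ._+ k) (ℕP.+-comm (h ∸ k) h)) (trans (ℕP.+-assoc h (h ∸ k) k) (cong (h ℕ.+_) (ℕP.m∸n+n≡m k≤h))))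

  reflected-pair : (h a b : ℕ) → a ℕ.< h → a ℕ.+ b ≡ h ℕ.+ h → h ∸ (h ∸ a) ≡ a × h ℕ.+ (h ∸ a) ≡ b
  reflected-pair h a b a<h a+b≡ =
    ℕP.m∸[m∸n]≡n (ℕP.<⇒≤ a<h) ,
    ℕP.+-cancelˡ-≡ a _ _ (trans (ℕP.+-comm a (h ℕ.+ (h ∸ a)))
      (trans (ℕP.+-assoc h (h ∸ a) a) (trans (cong (h ℕ.+_) (ℕP.m∸n+n≡m (ℕP.<⇒≤ a<h))) (sym a+b≡))))

  as-reflected-pair : (h a b : ℕ) → a ℕ.+ b ≡ h ℕ.+ h → a ≢ b →
    ∃[ k ] (1 ℕ.≤ k × k ℕ.≤ h × ((h ∸ k ≡ a × h ℕ.+ k ≡ b) ⊎ (h ∸ k ≡ b × h ℕ.+ k ≡ a)))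
  as-reflected-pair h a b a+b≡ a≢b with ℕP.<-cmp a h
  ... | tri< a<h _ _ = h ∸ a , ℕP.m<n⇒0<n∸m a<h , ℕP.m∸n≤m h a , inj₁ (reflected-pair h a b a<h a+b≡)
  ... | tri≈ _ refl _ = contradiction (ℕP.+-cancelˡ-≡ a a b (sym a+b≡)) a≢b
  ... | tri> _ _ h<a = h ∸ b , ℕP.m<n⇒0<n∸m b<h , ℕP.m∸n≤m h b , inj₂ (reflected-pair h b a b<h (trans (ℕP.+-comm b a) a+b≡))
    where
    b<h : b ℕ.< h
    b<h = ℕP.≰⇒> (λ h≤b → ℕP.<-irrefl (sym a+b≡) (ℕP.+-mono-<-≤ h<a h≤b))

  module SelfConjugateBlock (h : ℕ) (γ : List ℕ) (pγ : IsPartition γ) (core : IsCore (suc (h ℕ.+ h)) γ)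
                            (γ-self : conj γ ≡ γ) (ρ : ℕ → ℤ) (lowest : LowestBeads (suc (h ℕ.+ h)) γ ρ) where

    q : ℕ
    q = h ℕ.+ h

    g : ℤ → Bool
    g = bead γ

    dual : SelfDual g
    dual = selfConjugate⇒SelfDual γ pγ γ-self

    open Runners q γ ρ core dual lowest

    pair-selfConjugate : {μ : List ℕ} {a b : ℤ} → IsPartition μ → bead μ ≗ move₂ g a b (a + P) (b + P) →
      g a ≡ true → g b ≡ true → a ≢ b → a + b ≡ - + 1 - P → conj μ ≡ μ
    pair-selfConjugate {μ} {a} {b} pμ μ≗move₂ ga gb a≢b a+b≡ = SelfDual⇒selfConjugate μ pμ
      (SelfDual-≗ (λ y → sym (trans (μ≗move₂ y) (cong₂ (λ c d → move₂ g a b c d y) (shift a b a+b≡) (shift b a b+a≡))))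
                  (move₂-selfDual g dual ga gb a≢b))
      where
      b+a≡ : b + a ≡ - + 1 - P
      b+a≡ = trans (ℤP.+-comm b a) a+b≡
      shift : ∀ x y → x + y ≡ - + 1 - P → x + P ≡ - + 1 - y
      shift x y x+y≡ = trans (split x y P) (trans (cong (λ s → s + P - y) x+y≡) (cancel P y))
        where
        split : ∀ x y P → x + P ≡ x + y + P - y
        split = solve-∀
        cancel : ∀ P y → - + 1 - P + P - y ≡ - + 1 - y
        cancel = solve-∀

    pair-exists : (i j : ℕ) → i ℕ.< j → j ℕ.< p → i ℕ.+ j ≡ q →
      ∃[ μ ] (IsPair p γ ρ i j μ × InBlock p γ (size γ ℕ.+ 2 ℕ.* p) μ × conj μ ≡ μ)
    pair-exists i j i<j j<p i+j≡q = μ , μ≗move₂ , (pμ , size-μ , (μ→ν ◅ ν→γ ◅ ε) , core) , μ-self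
      where
      a b : ℤ
      a = ρ i
      b = ρ j
      a-lowest : IsLowest a
      a-lowest = ρ-lowest (ℕP.<-trans i<j j<p)
      b-lowest : IsLowest b
      b-lowest = ρ-lowest j<p
      a≢b : a ≢ b
      a≢b = ℤP.<⇒≢ (ρ-increasing i<j j<p)
      a+b≡ : a + b ≡ - + 1 - P
      a+b≡ = ρ-pair i j i+j≡q
      ν-step : ∃[ ν ] (IsPartition ν × bead ν ≗ move g a (a + P))
      ν-step = realize-move γ pγ {a} {a + P} (proj₁ a-lowest) (proj₂ a-lowest)
      ν : List ℕ
      ν = proj₁ ν-step
      pν : IsPartition ν
      pν = proj₁ (proj₂ ν-step)
      ν≗ : bead ν ≗ move g a (a + P)
      ν≗ = proj₂ (proj₂ ν-step)
      νb : bead ν b ≡ true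
      νb = trans (ν≗ b) (trans (move-other g (a≢b ∘ sym) (bead≢gap g (proj₁ b-lowest) (proj₂ a-lowest))) (proj₁ b-lowest))
      νb+P : bead ν (b + P) ≡ false
      νb+P = trans (ν≗ (b + P))
        (trans (move-other g (bead≢gap g (proj₁ a-lowest) (proj₂ b-lowest) ∘ sym) (a≢b ∘ sym ∘ +-cancelʳ-≡ P)) (proj₂ b-lowest))
      μ-step : ∃[ μ ] (IsPartition μ × bead μ ≗ move (bead ν) b (b + P))
      μ-step = realize-move ν pν {b} {b + P} νb νb+P
      μ : List ℕ
      μ = proj₁ μ-step
      pμ : IsPartition μ
      pμ = proj₁ (proj₂ μ-step)
      μ≗ : bead μ ≗ move (bead ν) b (b + P)
      μ≗ = proj₂ (proj₂ μ-step)
      μ≗move₂ : bead μ ≗ move₂ g a b (a + P) (b + P)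
      μ≗move₂ y = trans (μ≗ y) (trans (move-cong b (b + P) ν≗ y)
        (move∘move≗move₂ g a≢b (bead≢gap g (proj₁ a-lowest) (proj₂ b-lowest)) (a≢b ∘ +-cancelʳ-≡ P) y))
      μ→ν : HookStep p μ ν
      μ→ν = move⇒hookRemoval q {μ} {ν} {b} pν νb νb+P μ≗
      ν→γ : HookStep p ν γ
      ν→γ = move⇒hookRemoval q {ν} {γ} {a} pγ (proj₁ a-lowest) (proj₂ a-lowest) ν≗
      size-μ : size μ ≡ size γ ℕ.+ 2 ℕ.* p
      size-μ = trans (hookRemoval-size p pμ μ→ν) (trans (cong (ℕ._+ p) (hookRemoval-size p pν ν→γ))
        (trans (ℕP.+-assoc (size γ) p p) (cong (λ t → size γ ℕ.+ (p ℕ.+ t)) (sym (ℕP.+-identityʳ p)))))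
      μ-self : conj μ ≡ μ
      μ-self = pair-selfConjugate pμ μ≗move₂ (proj₁ a-lowest) (proj₁ b-lowest) a≢b a+b≡

    Classified : List ℕ → Set
    Classified μ = ∃[ k ] (1 ℕ.≤ k × k ℕ.≤ h × IsPair p γ ρ (h ∸ k) (h ℕ.+ k) μ)

    lowest-pair⇒classified : {μ : List ℕ} (a b : ℕ) → a ℕ.< p → b ℕ.< p → a ≢ b → ρ a + ρ b ≡ - + 1 - P →
      IsPair p γ ρ a b μ → Classified μ
    lowest-pair⇒classified {μ} a b a<p b<p a≢b ρa+ρb≡ pair with as-reflected-pair h a b a+b≡q a≢b
      where
      a≤q : a ℕ.≤ q
      a≤q = ℕP.≤-pred a<p
      ρb≡ : ρ b ≡ ρ (q ∸ a)
      ρb≡ = +-cancelˡ-≡ (ρ a) (trans ρa+ρb≡ (sym (ρ-pair a (q ∸ a) (ℕP.m+[n∸m]≡n a≤q))))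
      a+b≡q : a ℕ.+ b ≡ q
      a+b≡q = trans (cong (a ℕ.+_) (ρ-injective b<p (s≤s (ℕP.m∸n≤m q a)) ρb≡)) (ℕP.m+[n∸m]≡n a≤q)
    ... | k , 1≤k , k≤h , inj₁ (i≡a , j≡b) = k , 1≤k , k≤h , subst₂ (λ i j → IsPair p γ ρ i j μ) (sym i≡a) (sym j≡b) pair
    ... | k , 1≤k , k≤h , inj₂ (i≡b , j≡a) = k , 1≤k , k≤h ,
      subst₂ (λ i j → IsPair p γ ρ i j μ) (sym i≡b) (sym j≡a) (λ y → trans (pair y) (move₂-swap g (ρ a) (ρ b) (ρ a + P) (ρ b + P) y))

    module TwoHooks {μ ν : List ℕ} (pμ : IsPartition μ) (μ-self : conj μ ≡ μ) {y z : ℤ}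
                    (gy : g y ≡ true) (gy+P : g (y + P) ≡ false) (ν≗ : bead ν ≗ move g y (y + P))
                    (νz : bead ν z ≡ true) (νz+P : bead ν (z + P) ≡ false) (μ≗ : bead μ ≗ move (bead ν) z (z + P)) where

      F : ℤ → Bool
      F = move (move g y (y + P)) z (z + P)

      μ≗F : bead μ ≗ F
      μ≗F w = trans (μ≗ w) (move-cong z (z + P) ν≗ w)

      dualF : SelfDual F
      dualF = SelfDual-≗ μ≗F (selfConjugate⇒SelfDual μ pμ μ-self)

      new-bead-reflects : {w : ℤ} → F w ≡ true → g w ≡ false → - + 1 - w ≡ y ⊎ - + 1 - w ≡ z
      new-bead-reflects {w} Fw gw = move²-new-gap g (trans (SelfDual-reflect dualF w) (cong not Fw))
                                                    (trans (SelfDual-reflect dual w) (cong not gw))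

      new-gap-reflects : {w : ℤ} → F w ≡ false → g w ≡ true → - + 1 - w ≡ y + P ⊎ - + 1 - w ≡ z + P
      new-gap-reflects {w} Fw gw = move²-new-bead g (trans (SelfDual-reflect dualF w) (cong not Fw))
                                                     (trans (SelfDual-reflect dual w) (cong not gw))

      reflection-sum : (x : ℤ) {w : ℤ} → - + 1 - (x + P) ≡ w → x + w ≡ - + 1 - P
      reflection-sum x refl = cancel x P
        where
        cancel : ∀ x P → x + (- + 1 - (x + P)) ≡ - + 1 - P
        cancel = solve-∀

      x≢x+P : (x : ℤ) → x ≢ x + P
      x≢x+P x = ℤP.<⇒≢ (x<x+suc x q)

      z≢y : z ≢ y
      z≢y refl = contradiction (trans (sym νz) (trans (ν≗ z) (move-source g z (z + P)))) λ ()

      x≢x+P+P : (x : ℤ) → x ≢ x + P + P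
      x≢x+P+P x = ℤP.<⇒≢ (ℤP.<-trans (x<x+suc x q) (x<x+suc (x + P) q))

      z≢y+P : z ≢ y + P
      z≢y+P refl = impossible (new-gap-reflects Fy gy)
        where
        Fy : F y ≡ false
        Fy = trans (move-other (move g y (y + P)) (x≢x+P y) (x≢x+P+P y)) (move-source g y (y + P))
        F-1-y : F (- + 1 - y) ≡ true
        F-1-y = trans (SelfDual-reflect dualF y) (cong not Fy)
        regroup : ∀ y P → (y + P) + (y + P) ≡ y + P + P + y
        regroup = solve-∀
        cancel : ∀ y → - + 1 - y + y ≡ - + 1
        cancel = solve-∀
        impossible : - + 1 - y ≡ y + P ⊎ - + 1 - y ≡ y + P + P → ⊥
        impossible (inj₁ e) = contradiction (trans (sym (move-source (move g y (y + P)) (y + P) (y + P + P))) (trans (cong F (sym e)) F-1-y)) λ ()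
        impossible (inj₂ e) = double≢-1 (y + P) (trans (regroup y P) (trans (cong (_+ y) (sym e)) (cancel y)))

      z+P≢y : z + P ≢ y
      z+P≢y refl = impossible (new-bead-reflects Fy+P gy+P)
        where
        Fy+P : F (z + P + P) ≡ true
        Fy+P = trans (move-other (move g (z + P) (z + P + P)) (x≢x+P+P z ∘ sym) (x≢x+P (z + P) ∘ sym))
                     (move-target g (x≢x+P (z + P) ∘ sym))
        F-1-y-P : F (- + 1 - (z + P + P)) ≡ false
        F-1-y-P = trans (SelfDual-reflect dualF (z + P + P)) (cong not Fy+P)
        regroup : ∀ z P → (z + P) + (z + P) ≡ z + (z + P + P)
        regroup = solve-∀
        cancel : ∀ x → - + 1 - x + x ≡ - + 1
        cancel = solve-∀
        impossible : - + 1 - (z + P + P) ≡ z + P ⊎ - + 1 - (z + P + P) ≡ z → ⊥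
        impossible (inj₁ e) = contradiction (trans (sym (move-target (move g (z + P) (z + P + P)) (x≢x+P z ∘ sym)))
                                                   (trans (cong F (sym e)) F-1-y-P)) λ ()
        impossible (inj₂ e) = double≢-1 (z + P) (trans (regroup z P) (trans (cong (_+ (z + P + P)) (sym e)) (cancel (z + P + P))))

      gz : g z ≡ true
      gz = trans (sym (move-other g z≢y z≢y+P)) (trans (sym (ν≗ z)) νz)

      gz+P : g (z + P) ≡ false
      gz+P = trans (sym (move-other g z+P≢y (z≢y ∘ +-cancelʳ-≡ P))) (trans (sym (ν≗ (z + P))) νz+P)

      pair-sum : y + z ≡ - + 1 - P
      pair-sum = combine (new-bead-reflects Fy+P gy+P) (new-bead-reflects Fz+P gz+P)
        where
        Fy+P : F (y + P) ≡ true
        Fy+P = trans (move-other (move g y (y + P)) (z≢y+P ∘ sym) (z≢y ∘ sym ∘ +-cancelʳ-≡ P)) (move-target g (x≢x+P y ∘ sym))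
        Fz+P : F (z + P) ≡ true
        Fz+P = move-target (move g y (y + P)) (x≢x+P z ∘ sym)
        combine : - + 1 - (y + P) ≡ y ⊎ - + 1 - (y + P) ≡ z → - + 1 - (z + P) ≡ y ⊎ - + 1 - (z + P) ≡ z → y + z ≡ - + 1 - P
        combine (inj₂ e) _ = reflection-sum y e
        combine (inj₁ _) (inj₁ e) = trans (ℤP.+-comm y z) (reflection-sum z e)
        combine (inj₁ e) (inj₂ e′) = contradiction (double-injective (trans (reflection-sum y e) (sym (reflection-sum z e′)))) (z≢y ∘ sym)

      classified : Classified μ
      classified with lowest⇒ρ (gy , gy+P) | lowest⇒ρ (gz , gz+P)
      ... | a , a<p , refl | b , b<p , refl =
        lowest-pair⇒classified {μ} a b a<p b<p (z≢y ∘ sym ∘ cong ρ) pair-sum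
          (λ w → trans (μ≗F w) (move∘move≗move₂ g (z≢y ∘ sym) (z+P≢y ∘ sym) (z≢y ∘ sym ∘ +-cancelʳ-≡ P) w))

    classify : (n : ℕ) → size γ ℕ.+ 2 ℕ.* p ≡ n → (μ : List ℕ) → InBlock p γ n μ → conj μ ≡ μ → Classified μ
    classify n size≡ μ block@(pμ , _) μ-self with weight-two q size≡ block
    ... | ν , μ→ν , ν→γ with hookStep⇒move q {μ} {ν} μ→ν | hookStep⇒move q {ν} {γ} ν→γ
    ... | z , νz , νz+P , μ≗ | y , gy , gy+P , ν≗ = TwoHooks.classified {μ} {ν} pμ μ-self {y} {z} gy gy+P ν≗ νz νz+P μ≗

    construct : (n : ℕ) → size γ ℕ.+ 2 ℕ.* p ≡ n → (k : ℕ) → 1 ℕ.≤ k → k ℕ.≤ h →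
      ∃[ μ ] (IsPair p γ ρ (h ∸ k) (h ℕ.+ k) μ × InBlock p γ n μ × conj μ ≡ μ)
    construct n refl k 1≤k k≤h with reflected-indices h k 1≤k k≤h
    ... | i<j , j<p , i+j≡q = pair-exists (h ∸ k) (h ℕ.+ k) i<j j<p i+j≡q

open import Data.Nat using (ℕ; _+_; _*_; _∸_; _≤_)
open import Data.Nat.Primality using (Prime)
open import Data.Integer using (ℤ)
open import Data.List using (List)
open import Data.Product using (_×_; ∃-syntax)
open import Relation.Binary.PropositionalEquality using (_≡_)

lemma3p2 : (p h n : ℕ) → Prime p → p ≡ 2 * h + 1 →
    (γ : List ℕ) → IsPartition γ → IsCore p γ → conj γ ≡ γ → size γ + 2 * p ≡ n →
    (ρ : ℕ → ℤ) → LowestBeads p γ ρ →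
    ((μ : List ℕ) → InBlock p γ n μ → conj μ ≡ μ →
       ∃[ k ] (1 ≤ k × k ≤ h × IsPair p γ ρ (h ∸ k) (h + k) μ))
    × ((k : ℕ) → 1 ≤ k → k ≤ h →
       ∃[ μ ] (IsPair p γ ρ (h ∸ k) (h + k) μ × InBlock p γ n μ × conj μ ≡ μ))
lemma3p2 p h n _ p≡2h+1 γ pγ core γ-self size≡ ρ lowest with p≡suc[h+h]
  where
  p≡suc[h+h] : p ≡ suc (h + h)
  p≡suc[h+h] = trans p≡2h+1 (trans (ℕP.+-comm (2 * h) 1) (cong (λ t → ℕ.suc (h + t)) (ℕP.+-identityʳ h)))
... | refl = classify n size≡ , construct n size≡
  where
  open SelfConjugateBlock h γ pγ core γ-self ρ lowest
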